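{- Let $\mathbf G$ be a finite group with a unique $p$-Sylow subgroup $\mathbf G_p$ for a prime $p$. Then every $p$-component of $\mathcal G_e(\mathbf G)$ is isomorphic to $\mathcal G_e(\mathbf G_p)$.
   Context: The enhanced power graph $\mathcal G_e(\mathbf G)$ of a group $\mathbf G$ is the simple graph on $G$ in which distinct $x,y$ are adjacent iff there is $z\in G$ with $x,y\in\langle z\rangle$. For a finite graph $\Gamma$ with set of maximal cliques $\{C_1,\dots,C_n\}$, let $\mathcal B=\{\bigcap_{i\in M}C_i\mid \emptyset\neq M\subseteq\{1,\dots,n\}\}$. A $p$-component of $\Gamma$ is any induced subgraph $\Gamma_p$ of $\Gamma$ such that for each $B\in\mathcal B$ with $|B|=p^kl$, $p\nmid l$, the set $B$ contains exactly $p^k$ vertices of $\Gamma_p$. -}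

module Defs where

open import Level using (0ℓ)
open import Data.Nat using (ℕ; zero; suc; _*_; _^_)
open import Data.Nat.Divisibility using (_∣_)
open import Data.Integer using (ℤ; +_; -[1+_])
open import Data.Fin using (Fin)
open import Data.Fin.Subset using (Subset; _∈_; _∩_; ⋂; ∣_∣)
open import Data.List using (List; _∷_)
open import Data.List.Relation.Unary.All using (All)
open import Data.Product using (Σ; ∃; _×_; _,_; proj₁)
open import Relation.Binary.PropositionalEquality using (_≡_; _≢_)
open import Relation.Nullary using (¬_)
open import Algebra.Structures using (IsGroup)
open import Function.Bundles using (_⤖_; Bijection)

-- Finite groups: a group whose carrier is Fin n (every finite group of
-- order n is isomorphic to one of these).

record FinGroup (n : ℕ) : Set where
  field
    _∙_     : Fin n → Fin n → Fin n
    ε       : Fin n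
    _⁻¹     : Fin n → Fin n
    isGroup : IsGroup _≡_ _∙_ ε _⁻¹

module _ {n : ℕ} (G : FinGroup n) where
  open FinGroup G

  powℕ : Fin n → ℕ → Fin n
  powℕ z zero    = ε
  powℕ z (suc k) = z ∙ powℕ z k

  pow : Fin n → ℤ → Fin n
  pow z (+ k)      = powℕ z k
  pow z -[1+ k ]   = powℕ (z ⁻¹) (suc k)

  InCyclic : Fin n → Fin n → Set
  InCyclic x z = ∃ λ (k : ℤ) → x ≡ pow z k

  IsSubgroup : Subset n → Set
  IsSubgroup S = (ε ∈ S)
               × (∀ x y → x ∈ S → y ∈ S → (x ∙ y) ∈ S)
               × (∀ x → x ∈ S → (x ⁻¹) ∈ S)

  IsSylow : ℕ → Subset n → Set
  IsSylow p S = IsSubgroup S ×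
    (∃ λ (k : ℕ) → (∣ S ∣ ≡ p ^ k) × (∃ λ (m : ℕ) → (n ≡ p ^ k * m) × ¬ (p ∣ m)))

  EPGAdj : Fin n → Fin n → Set
  EPGAdj x y = (x ≢ y) × (∃ λ z → InCyclic x z × InCyclic y z)

record Graph : Set₁ where
  field
    Vertex : Set
    Adj    : Vertex → Vertex → Set

open Graph public

Iso : Graph → Graph → Set
Iso Γ Δ = Σ (Vertex Γ ⤖ Vertex Δ) λ f →
  ∀ a b → (Adj Γ a b → Adj Δ (Bijection.to f a) (Bijection.to f b))
        × (Adj Δ (Bijection.to f a) (Bijection.to f b) → Adj Γ a b)

module _ {n : ℕ} (E : Fin n → Fin n → Set) where

  finGraph : Graph
  finGraph = record { Vertex = Fin n ; Adj = E }

  Induced : Subset n → Graph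
  Induced V = record { Vertex = Σ (Fin n) (λ x → x ∈ V)
                     ; Adj    = λ a b → E (proj₁ a) (proj₁ b) }

  IsClique : Subset n → Set
  IsClique C = ∀ x y → x ∈ C → y ∈ C → x ≢ y → E x y

  IsMaximalClique : Subset n → Set
  IsMaximalClique C = IsClique C × (∀ D → IsClique D → (∀ x → x ∈ C → x ∈ D) → D ≡ C)

  InB : Subset n → Set
  InB B = ∃ λ (C : Subset n) → ∃ λ (Cs : List (Subset n)) →
            IsMaximalClique C × All IsMaximalClique Cs × (B ≡ ⋂ (C ∷ Cs))

  IsPComponent : ℕ → Subset n → Set
  IsPComponent p V = ∀ B → InB B → ∀ (k l : ℕ) →
    ∣ B ∣ ≡ p ^ k * l → ¬ (p ∣ l) → ∣ B ∩ V ∣ ≡ p ^ k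

-- the enhanced power graph of G, and of a subgroup S (as a group in its own right)
EnhancedPowerGraph : ∀ {n} → FinGroup n → Graph
EnhancedPowerGraph G = finGraph (EPGAdj G)

EnhancedPowerGraphSub : ∀ {n} → FinGroup n → Subset n → Graph
EnhancedPowerGraphSub {n} G S = record
  { Vertex = Σ (Fin n) (λ x → x ∈ S)
  ; Adj    = λ a b → (proj₁ a ≢ proj₁ b) ×
      (∃ λ z → z ∈ S × InCyclic G (proj₁ a) z × InCyclic G (proj₁ b) z) }

module Submission where

-- For w ∈ G let B(w) be the intersection of the maximal cyclic subgroups containing w. It is a
-- member of 𝓑 (maximal cyclic subgroups are maximal cliques) and a subgroup of a cyclic group,
-- hence cyclic, of order pᵏl say. The p-component condition gives |B(w) ∩ V| = pᵏ; since the
-- unique Sylow subgroup Gp is normal it contains every p-element, so |B(w) ∩ Gp| = pᵏ too.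
-- Grouping elements by the value of B and inducting on |B(w)| shows that V and Gp meet each
-- class equally often, which yields a bijection V → Gp preserving B. Adjacency only depends on
-- the maximal cyclic subgroups through the two endpoints, which B determines, and two elements
-- of Gp in a common ⟨ z ⟩ lie in the cyclic subgroup ⟨ z ⟩ ∩ Gp of Gp. Hence the bijection is
-- a graph isomorphism.

open import Defs
open import Data.Nat using (ℕ)
open import Data.Nat.Primality using (Prime)
open import Data.Fin.Subset using (Subset)
open import Relation.Binary.PropositionalEquality using (_≡_)

open import Level using (0ℓ)
open import Algebra.Bundles using (Group; CommutativeMonoid)
import Algebra.Properties.CommutativeMonoid.Sum
import Algebra.Properties.CommutativeSemigroup as CommSemigroupProps
import Algebra.Properties.Group
open import Data.Bool using (Bool; true; false; _∧_; _∨_; not)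
open import Data.Bool.Properties using (∧-conicalˡ; ∧-conicalʳ)
import Data.Bool.Properties as Boolₚ
open import Data.Empty using (⊥; ⊥-elim)
open import Data.Fin using (Fin; zero; suc; _≟_; toℕ; fromℕ<)
open import Data.Fin.Permutation using (permutation)
open import Data.Fin.Properties using (any?; all?; ¬∀⟶∃¬; pigeonhole; toℕ<n; toℕ-fromℕ<; toℕ-injective)
  renaming (suc-injective to fsuc-injective)
open import Data.Fin.Subset using (_∈_; ∣_∣; ⋂)
import Data.Fin.Subset as Sub
open import Data.Fin.Subset.Properties using (∈⊤; x∈p∩q⁺; x∈p∩q⁻; ⊆-antisym)
open import Data.Integer using (-[1+_]) renaming (+_ to pos)
open import Data.List using (List; _∷_; []; map; filter; allFin)
import Data.List.Membership.Propositional as Listₘ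
import Data.List.Membership.Propositional.Properties as Listₚ
open import Data.List.Relation.Unary.All using (All; _∷_; [])
import Data.List.Relation.Unary.All as All
import Data.List.Relation.Unary.All.Properties as Allₚ
open import Data.Nat using (zero; suc; _+_; _*_; _∸_; _^_; _≤_; _<_; z≤n; s≤s; NonZero; pred;
                            >-nonZero; >-nonZero⁻¹; nonTrivial⇒n>1)
open import Data.Nat.Coprimality using (Coprime; coprime-divisor)
open import Data.Nat.Divisibility
open import Data.Nat.DivMod
open import Data.Nat.Induction using (<-rec)
open import Data.Nat.Primality using (prime⇒irreducible; prime⇒nonTrivial; prime⇒nonZero)
open import Data.Nat.Properties hiding (_≟_)
open import Algebra.Properties.CommutativeSemigroup +-commutativeSemigroup using (interchange)
open import Data.Product using (Σ; ∃; _×_; _,_; proj₁; proj₂)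
open import Data.Sum using (_⊎_; inj₁; inj₂)
open import Data.Vec using (_∷_; []; lookup; tabulate)
open import Data.Vec.Properties using ([]=⇒lookup; lookup⇒[]=; lookup∘tabulate; lookup-zipWith; ≡-dec)
open import Data.Vec.Properties.WithK using ([]=-irrelevant)
open import Function using (_∘_; case_of_)
open import Function.Bundles using (mk⤖)
open import Relation.Binary.Definitions using (DecidableEquality)
open import Relation.Binary.PropositionalEquality
  using (_≢_; refl; sym; trans; cong; cong₂; subst; subst₂; module ≡-Reasoning)
open import Relation.Nullary using (¬_; Dec; yes; no; does)
open import Relation.Nullary.Decidable using (_×-dec_; _→-dec_)

∧-intro : ∀ {a b} → a ≡ true → b ≡ true → a ∧ b ≡ true
∧-intro refl refl = refl

true≢false : ∀ {a} → a ≡ true → a ≡ false → ⊥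
true≢false refl ()

not-true : ∀ {a} → not a ≡ true → a ≡ false
not-true {false} _ = refl

bool-ext : ∀ {a b : Bool} → (a ≡ true → b ≡ true) → (b ≡ true → a ≡ true) → a ≡ b
bool-ext {true}  {true}  f g = refl
bool-ext {true}  {false} f g = sym (f refl)
bool-ext {false} {true}  f g = g refl
bool-ext {false} {false} f g = refl

bool-irrelevant : ∀ {a b : Bool} (p q : a ≡ b) → p ≡ q
bool-irrelevant refl refl = refl

module Counting where

  bit : Bool → ℕ
  bit true  = 1
  bit false = 0

  count : ∀ {n} → (Fin n → Bool) → ℕ
  count {zero}  f = 0
  count {suc n} f = bit (f zero) + count (f ∘ suc)

  ⁅_⁆ : ∀ {n} → Fin n → Fin n → Bool
  ⁅ x ⁆ y = does (x ≟ y)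

  infixr 7 _∩_
  _∩_ : ∀ {n} → (Fin n → Bool) → (Fin n → Bool) → Fin n → Bool
  (f ∩ g) x = f x ∧ g x

  without : ∀ {n} → Fin n → (Fin n → Bool) → Fin n → Bool
  without x f = f ∩ (not ∘ ⁅ x ⁆)

  witness-or-empty : ∀ {n} (f : Fin n → Bool) → (∃ λ x → f x ≡ true) ⊎ (∀ x → f x ≡ false)
  witness-or-empty f with any? (λ x → f x Boolₚ.≟ true)
  ... | yes w  = inj₁ w
  ... | no ¬w = inj₂ λ x → Boolₚ.¬-not (λ fx → ¬w (x , fx))

  ∣∣≡count : ∀ {n} (S : Subset n) → ∣ S ∣ ≡ count (lookup S)
  ∣∣≡count []          = refl
  ∣∣≡count (true ∷ S)  = cong suc (∣∣≡count S)
  ∣∣≡count (false ∷ S) = ∣∣≡count S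

  count-cong : ∀ {n} {f g : Fin n → Bool} → (∀ x → f x ≡ g x) → count f ≡ count g
  count-cong {zero}  e = refl
  count-cong {suc n} e = cong₂ _+_ (cong bit (e zero)) (count-cong (e ∘ suc))

  count-false : ∀ {n} (f : Fin n → Bool) → (∀ x → f x ≡ false) → count f ≡ 0
  count-false {zero}  f e = refl
  count-false {suc n} f e rewrite e zero = count-false (f ∘ suc) (e ∘ suc)

  count-true : ∀ {n} (f : Fin n → Bool) → (∀ x → f x ≡ true) → count f ≡ n
  count-true {zero}  f e = refl
  count-true {suc n} f e rewrite e zero = cong suc (count-true (f ∘ suc) (e ∘ suc))

  count-split : ∀ {n} (f g : Fin n → Bool) → count f ≡ count (f ∩ g) + count (f ∩ (not ∘ g))
  count-split {zero}  f g = refl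
  count-split {suc n} f g =
    trans (cong₂ _+_ (bit-split (f zero) (g zero)) (count-split (f ∘ suc) (g ∘ suc)))
          (interchange (bit (f zero ∧ g zero)) _ _ _)
    where
    bit-split : ∀ a b → bit a ≡ bit (a ∧ b) + bit (a ∧ not b)
    bit-split true  true  = refl
    bit-split true  false = refl
    bit-split false b     = refl

  count-mono : ∀ {n} (f g : Fin n → Bool) → (∀ x → f x ≡ true → g x ≡ true) → count f ≤ count g
  count-mono {zero}  f g h = z≤n
  count-mono {suc n} f g h = +-mono-≤ (bit-mono (h zero)) (count-mono (f ∘ suc) (g ∘ suc) (h ∘ suc))
    where
    bit-mono : ∀ {a b} → (a ≡ true → b ≡ true) → bit a ≤ bit b
    bit-mono {false} h = z≤n
    bit-mono {true}  h rewrite h refl = s≤s z≤n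

  count≤n : ∀ {n} (f : Fin n → Bool) → count f ≤ n
  count≤n f = subst (count f ≤_) (count-true (λ _ → true) (λ _ → refl))
                    (count-mono f (λ _ → true) (λ _ _ → refl))

  count-witness : ∀ {n} (f : Fin n → Bool) → 0 < count f → ∃ λ x → f x ≡ true
  count-witness {suc n} f p with f zero in eq
  ... | true  = zero , eq
  ... | false with count-witness (f ∘ suc) p
  ...   | x , q = suc x , q

  without⁺ : ∀ {n} (f : Fin n → Bool) {x y} → f y ≡ true → x ≢ y → without x f y ≡ true
  without⁺ f {x} {y} fy x≢y with x ≟ y
  ... | yes x≡y = ⊥-elim (x≢y x≡y)
  ... | no _    = cong (_∧ true) fy

  without⁻ : ∀ {n} (f : Fin n → Bool) {x y} → without x f y ≡ true → x ≢ y
  without⁻ f {x} {y} e x≡y with x ≟ y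
  ... | yes _   = true≢false (∧-conicalʳ (f y) _ e) refl
  ... | no x≢y = x≢y x≡y

  count-⁅⁆ : ∀ {n} (x : Fin n) → count ⁅ x ⁆ ≡ 1
  count-⁅⁆ {suc n} zero    = cong suc (count-false {n} (λ y → ⁅ zero ⁆ (suc y)) (λ _ → refl))
  count-⁅⁆ {suc n} (suc x) = trans (count-cong ⁅suc⁆) (count-⁅⁆ x)
    where
    ⁅suc⁆ : ∀ y → ⁅ suc x ⁆ (suc y) ≡ ⁅ x ⁆ y
    ⁅suc⁆ y with x ≟ y
    ... | yes refl = refl
    ... | no _     = refl

  count-without : ∀ {n} (f : Fin n → Bool) (x : Fin n) → f x ≡ true →
    count f ≡ suc (count (without x f))
  count-without f x fx = trans (count-split f ⁅ x ⁆)
    (cong (_+ count (without x f)) (trans (count-cong f∧⁅x⁆) (count-⁅⁆ x)))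
    where
    f∧⁅x⁆ : ∀ y → f y ∧ ⁅ x ⁆ y ≡ ⁅ x ⁆ y
    f∧⁅x⁆ y with x ≟ y
    ... | yes refl = cong (_∧ true) fx
    ... | no _     = Boolₚ.∧-zeroʳ (f y)

  count-positive : ∀ {n} (f : Fin n → Bool) x → f x ≡ true → 0 < count f
  count-positive f x fx = subst (0 <_) (sym (count-without f x fx)) (s≤s z≤n)

  count-without-∩ : ∀ {n} (f g : Fin n → Bool) x → f x ≡ true → g x ≡ true →
    count (f ∩ g) ≡ suc (count (without x f ∩ g))
  count-without-∩ f g x fx gx = trans (count-without (f ∩ g) x (∧-intro fx gx))
    (cong suc (count-cong (λ y → ∧-Props.xy∙z≈xz∙y (f y) (g y) _)))
    where
    module ∧-Props = CommSemigroupProps (CommutativeMonoid.commutativeSemigroup Boolₚ.∧-commutativeMonoid)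

  count-without-∩-outside : ∀ {n} (f g : Fin n → Bool) x → g x ≡ false →
    count (without x f ∩ g) ≡ count (f ∩ g)
  count-without-∩-outside f g x gx = count-cong same
    where
    same : ∀ y → (without x f ∩ g) y ≡ (f ∩ g) y
    same y with x ≟ y
    ... | yes refl = trans (Boolₚ.∧-assoc (f x) false (g x)) (trans (Boolₚ.∧-zeroʳ (f x))
                       (sym (trans (cong (f x ∧_) gx) (Boolₚ.∧-zeroʳ (f x)))))
    ... | no _     = cong (_∧ g y) (Boolₚ.∧-identityʳ (f y))

  ⊆∧count≤⇒⊇ : ∀ {n} (f g : Fin n → Bool) → (∀ x → f x ≡ true → g x ≡ true) →
    count g ≤ count f → ∀ x → g x ≡ true → f x ≡ true
  ⊆∧count≤⇒⊇ f g f⊆g g≤f x gx with f x in fx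
  ... | true  = refl
  ... | false = ⊥-elim (<⇒≱ f<g g≤f)
    where
    f⊆g-x : ∀ y → f y ≡ true → without x g y ≡ true
    f⊆g-x y fy with x ≟ y
    ... | yes refl = ⊥-elim (true≢false fy fx)
    ... | no _     = cong (_∧ true) (f⊆g y fy)
    f<g : count f < count g
    f<g = ≤-<-trans (count-mono f _ f⊆g-x) (subst (count (without x g) <_) (sym (count-without g x gx)) ≤-refl)

  count-permute : ∀ {n} (f : Fin n → Bool) (π π⁻¹ : Fin n → Fin n) →
    (∀ x → π (π⁻¹ x) ≡ x) → (∀ x → π⁻¹ (π x) ≡ x) → count (f ∘ π) ≡ count f
  count-permute f π π⁻¹ inverseˡ inverseʳ = begin
    count (f ∘ π)          ≡⟨ count≡sum (f ∘ π) ⟩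
    Sum.sum (bit ∘ f ∘ π)  ≡⟨ Sum.sum-permute (bit ∘ f) (permutation π π⁻¹ inverseˡ inverseʳ) ⟨
    Sum.sum (bit ∘ f)      ≡⟨ count≡sum f ⟨
    count f                ∎
    where
    open ≡-Reasoning
    module Sum = Algebra.Properties.CommutativeMonoid.Sum +-0-commutativeMonoid
    count≡sum : ∀ {n} (f : Fin n → Bool) → count f ≡ Sum.sum (bit ∘ f)
    count≡sum {zero}  f = refl
    count≡sum {suc n} f = cong (bit (f zero) +_) (count≡sum (f ∘ suc))

  count-∨ : ∀ {n} (f g : Fin n → Bool) → (∀ x → f x ≡ true → g x ≡ false) →
    count (λ x → f x ∨ g x) ≡ count f + count g
  count-∨ f g disjoint =
    trans (count-split (λ x → f x ∨ g x) f) (cong₂ _+_ (count-cong ∨∧f) (count-cong ∨∧¬f))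
    where
    ∨∧f : ∀ x → (f x ∨ g x) ∧ f x ≡ f x
    ∨∧f x with f x
    ... | true  = refl
    ... | false = Boolₚ.∧-zeroʳ (g x)
    ∨∧¬f : ∀ x → (f x ∨ g x) ∧ not (f x) ≡ g x
    ∨∧¬f x with f x in fx
    ... | true  = sym (disjoint x fx)
    ... | false = Boolₚ.∧-identityʳ (g x)

  count-image : ∀ {m n} (h : Fin m → Fin n) → (∀ i j → h i ≡ h j → i ≡ j) →
    (S : Fin n → Bool) → (∀ y → S y ≡ true → ∃ λ i → h i ≡ y) → (∀ i → S (h i) ≡ true) →
    count S ≡ m
  count-image {zero} h inj S onto into = count-false S empty
    where
    empty : ∀ y → S y ≡ false
    empty y with S y in sy
    ... | false = refl
    ... | true with onto y sy
    ...   | () , _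
  count-image {suc m} {n} h inj S onto into =
    trans (count-without S (h zero) (into zero))
          (cong suc (count-image (h ∘ suc) (λ i j e → fsuc-injective (inj (suc i) (suc j) e))
                                 (without (h zero) S) onto′ into′))
    where
    onto′ : ∀ y → without (h zero) S y ≡ true → ∃ λ i → h (suc i) ≡ y
    onto′ y e with S y in sy | h zero ≟ y
    onto′ y () | false | _
    onto′ y () | true  | yes _
    onto′ y e  | true  | no h0≢y with onto y sy
    ... | zero  , q = ⊥-elim (h0≢y q)
    ... | suc i , q = i , q
    into′ : ∀ i → without (h zero) S (h (suc i)) ≡ true
    into′ i with h zero ≟ h (suc i)
    ... | yes q with inj zero (suc i) q
    ...   | ()
    into′ i | no _ = cong (_∧ true) (into (suc i))

  unionBelow : ∀ {n} → ℕ → (ℕ → Fin n → Bool) → Fin n → Bool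
  unionBelow zero    A x = false
  unionBelow (suc s) A x = A s x ∨ unionBelow s A x

  unionBelow⁻ : ∀ {n} s (A : ℕ → Fin n → Bool) x → unionBelow s A x ≡ true →
    ∃ λ i → i < s × A i x ≡ true
  unionBelow⁻ (suc s) A x e with A s x in ax
  ... | true  = s , ≤-refl , ax
  ... | false with unionBelow⁻ s A x e
  ...   | i , i<s , q = i , m<n⇒m<1+n i<s , q

  unionBelow⁺ : ∀ {n} s (A : ℕ → Fin n → Bool) x i → i < s → A i x ≡ true →
    unionBelow s A x ≡ true
  unionBelow⁺ (suc s) A x i i<1+s e with A s x in ax
  ... | true  = refl
  ... | false with m≤n⇒m<n∨m≡n (≤-pred i<1+s)
  ...   | inj₁ i<s  = unionBelow⁺ s A x i i<s e
  ...   | inj₂ refl = ⊥-elim (true≢false e ax)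

  count-unionBelow : ∀ {n} s (A : ℕ → Fin n → Bool) c →
    (∀ i j x → i < j → j < s → A i x ≡ true → A j x ≡ false) →
    (∀ i → count (A i) ≡ c) → count (unionBelow s A) ≡ s * c
  count-unionBelow zero    A c disjoint size = count-false (unionBelow zero A) (λ _ → refl)
  count-unionBelow (suc s) A c disjoint size =
    trans (count-∨ (A s) (unionBelow s A) Aₛ-disjoint)
          (cong₂ _+_ (size s)
                 (count-unionBelow s A c (λ i j x i<j j<s → disjoint i j x i<j (m<n⇒m<1+n j<s)) size))
    where
    Aₛ-disjoint : ∀ x → A s x ≡ true → unionBelow s A x ≡ false
    Aₛ-disjoint x e with unionBelow s A x in u
    ... | false = refl
    ... | true with unionBelow⁻ s A x u
    ...   | i , i<s , q = ⊥-elim (true≢false e (disjoint i s x i<s ≤-refl q))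

module SubsetsAsPredicates {n : ℕ} where

  open Counting

  ∣∩∣≡count : (A B : Subset n) → ∣ A Sub.∩ B ∣ ≡ count (lookup A ∩ lookup B)
  ∣∩∣≡count A B = trans (∣∣≡count (A Sub.∩ B)) (count-cong (λ x → lookup-zipWith _∧_ x A B))

  ∈⇒lookup : ∀ {S : Subset n} {x} → x ∈ S → lookup S x ≡ true
  ∈⇒lookup = []=⇒lookup

  lookup⇒∈ : ∀ {S : Subset n} {x} → lookup S x ≡ true → x ∈ S
  lookup⇒∈ {S} {x} = lookup⇒[]= x S

  ∈-tabulate⁺ : ∀ {f : Fin n → Bool} {x} → f x ≡ true → x ∈ tabulate f
  ∈-tabulate⁺ {f} {x} fx = lookup⇒∈ (trans (lookup∘tabulate f x) fx)

  ∈-tabulate⁻ : ∀ {f : Fin n → Bool} {x} → x ∈ tabulate f → f x ≡ true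
  ∈-tabulate⁻ {f} {x} x∈ = trans (sym (lookup∘tabulate f x)) (∈⇒lookup x∈)

  ∈⋂⁺ : ∀ {Cs : List (Subset n)} {x} → All (x ∈_) Cs → x ∈ ⋂ Cs
  ∈⋂⁺ []         = ∈⊤
  ∈⋂⁺ (x∈C ∷ x∈Cs) = x∈p∩q⁺ (x∈C , ∈⋂⁺ x∈Cs)

  ∈⋂⁻ : ∀ (Cs : List (Subset n)) {x} → x ∈ ⋂ Cs → All (x ∈_) Cs
  ∈⋂⁻ []       _   = []
  ∈⋂⁻ (C ∷ Cs) x∈ = proj₁ (x∈p∩q⁻ C (⋂ Cs) x∈) ∷ ∈⋂⁻ Cs (proj₂ (x∈p∩q⁻ C (⋂ Cs) x∈))

module Classes {n : ℕ} (same : Fin n → Fin n → Bool)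
  (same-refl : ∀ x → same x x ≡ true)
  (same-trans : ∀ x y → same x y ≡ true → ∀ z → same y z ≡ same x z) where

  open Counting

  Saturated : (Fin n → Bool) → Set
  Saturated D = ∀ x y → D x ≡ true → same x y ≡ true → D y ≡ true

  removeClass : Fin n → (Fin n → Bool) → Fin n → Bool
  removeClass x D = D ∩ (not ∘ same x)

  same-sym : ∀ x y → same x y ≡ true → same y x ≡ true
  same-sym x y xy = trans (same-trans x y xy x) (same-refl x)

  removeClass-saturated : ∀ x D → Saturated D → Saturated (removeClass x D)
  removeClass-saturated x D satD y z e yz with same x z in xz
  ... | false = cong (_∧ true) (satD y z (∧-conicalˡ _ _ e) yz)
  ... | true  = ⊥-elim (true≢false x~y (not-true (∧-conicalʳ (D y) _ e)))
    where
    x~y : same x y ≡ true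
    x~y = trans (sym (same-trans x z xz y)) (same-sym y z yz)

  ∩-class : ∀ D x → Saturated D → D x ≡ true → ∀ y → (D ∩ same x) y ≡ same x y
  ∩-class D x satD dx y with same x y in xy
  ... | true  = cong (_∧ true) (satD x y dx xy)
  ... | false = Boolₚ.∧-zeroʳ (D y)

  count-removeClass : ∀ W D x → Saturated D → D x ≡ true →
    count (W ∩ D) ≡ count (W ∩ same x) + count (W ∩ removeClass x D)
  count-removeClass W D x satD dx =
    trans (count-split (W ∩ D) (same x)) (cong₂ _+_ (count-cong W∩D∩class) (count-cong ∩-assoc))
    where
    W∩D∩class : ∀ y → ((W ∩ D) ∩ same x) y ≡ (W ∩ same x) y
    W∩D∩class y = trans (Boolₚ.∧-assoc (W y) (D y) _) (cong (W y ∧_) (∩-class D x satD dx y))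
    ∩-assoc : ∀ y → ((W ∩ D) ∩ (not ∘ same x)) y ≡ (W ∩ removeClass x D) y
    ∩-assoc y = Boolₚ.∧-assoc (W y) (D y) _

  saturated-induction : (Q : (Fin n → Bool) → Set) →
    (∀ D → (∀ x → D x ≡ false) → Q D) →
    (∀ D x → Saturated D → D x ≡ true → Q (removeClass x D) → Q D) →
    ∀ D → Saturated D → Q D
  saturated-induction Q base step D satD = go n D satD (count≤n D)
    where
    go : ∀ k D → Saturated D → count D ≤ k → Q D
    go k D satD D≤k with witness-or-empty D
    ... | inj₂ empty = base D empty
    go zero    D satD D≤0   | inj₁ (x , dx) = ⊥-elim (<⇒≱ (count-positive D x dx) D≤0)
    go (suc k) D satD D≤1+k | inj₁ (x , dx) =
      step D x satD dx (go k (removeClass x D) (removeClass-saturated x D satD) smaller)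
      where
      split : count D ≡ count (same x) + count (removeClass x D)
      split = count-removeClass (λ _ → true) D x satD dx
      smaller : count (removeClass x D) ≤ k
      smaller = ≤-pred (≤-trans (+-monoˡ-≤ _ (count-positive (same x) x (same-refl x)))
                                (≤-trans (≤-reflexive (sym split)) D≤1+k))

  classSize∣count : ∀ c → (∀ x → count (same x) ≡ c) → ∀ D → Saturated D → c ∣ count D
  classSize∣count c size = saturated-induction (λ D → c ∣ count D)
    (λ D empty → subst (c ∣_) (sym (count-false D empty)) (c ∣0))
    (λ D x satD dx c∣rest → subst (c ∣_) (sym (count-removeClass (λ _ → true) D x satD dx))
                                  (∣m∣n⇒∣m+n (∣-reflexive (sym (size x))) c∣rest))

module Classifier {n : ℕ} {K : Set} (_≟K_ : DecidableEquality K) (c : Fin n → K) where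

  open Counting

  sameClass : Fin n → Fin n → Bool
  sameClass x y = does (c x ≟K c y)

  sameClass⁺ : ∀ {x y} → c x ≡ c y → sameClass x y ≡ true
  sameClass⁺ {x} {y} eq with c x ≟K c y
  ... | yes _  = refl
  ... | no neq = ⊥-elim (neq eq)

  sameClass⁻ : ∀ {x y} → sameClass x y ≡ true → c x ≡ c y
  sameClass⁻ {x} {y} e with c x ≟K c y
  ... | yes eq = eq

  sameClass-false : ∀ {x y} → c x ≢ c y → sameClass x y ≡ false
  sameClass-false {x} {y} neq with c x ≟K c y
  ... | yes eq = ⊥-elim (neq eq)
  ... | no _   = refl

  sameClass-trans : ∀ x y → sameClass x y ≡ true → ∀ z → sameClass y z ≡ sameClass x z
  sameClass-trans x y xy z = bool-ext
    (λ yz → sameClass⁺ (trans (sameClass⁻ xy) (sameClass⁻ yz)))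
    (λ xz → sameClass⁺ (trans (sym (sameClass⁻ xy)) (sameClass⁻ xz)))

  open Classes sameClass (λ x → sameClass⁺ refl) sameClass-trans public

  ClassCountsAgree : (V P : Fin n → Bool) → Set
  ClassCountsAgree V P = ∀ x → count (V ∩ sameClass x) ≡ count (P ∩ sameClass x)

  count-saturated : ∀ V P D → Saturated D →
    (∀ x → D x ≡ true → count (V ∩ sameClass x) ≡ count (P ∩ sameClass x)) →
    count (V ∩ D) ≡ count (P ∩ D)
  count-saturated V P = saturated-induction Q base step
    where
    Q : (Fin n → Bool) → Set
    Q D = (∀ x → D x ≡ true → count (V ∩ sameClass x) ≡ count (P ∩ sameClass x)) →
          count (V ∩ D) ≡ count (P ∩ D)
    ∩-empty : ∀ W D → (∀ x → D x ≡ false) → count (W ∩ D) ≡ 0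
    ∩-empty W D empty = count-false (W ∩ D) (λ y → trans (cong (W y ∧_) (empty y)) (Boolₚ.∧-zeroʳ (W y)))
    base : ∀ D → (∀ x → D x ≡ false) → Q D
    base D empty _ = trans (∩-empty V D empty) (sym (∩-empty P D empty))
    step : ∀ D x → Saturated D → D x ≡ true → Q (removeClass x D) → Q D
    step D x satD dx rest agree = begin
      count (V ∩ D)                                         ≡⟨ count-removeClass V D x satD dx ⟩
      count (V ∩ sameClass x) + count (V ∩ removeClass x D) ≡⟨ cong₂ _+_ (agree x dx) rest′ ⟩
      count (P ∩ sameClass x) + count (P ∩ removeClass x D) ≡⟨ count-removeClass P D x satD dx ⟨
      count (P ∩ D)                                         ∎
      where
      open ≡-Reasoning
      rest′ : count (V ∩ removeClass x D) ≡ count (P ∩ removeClass x D)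
      rest′ = rest (λ y e → agree y (∧-conicalˡ _ _ e))

  ClassCountsAgree-without : ∀ V P x y → V x ≡ true → P y ≡ true → c x ≡ c y →
    ClassCountsAgree V P → ClassCountsAgree (without x V) (without y P)
  ClassCountsAgree-without V P x y vx py cx≡cy agree w with c w ≟K c x
  ... | yes cw≡cx = suc-injective (begin
    suc (count (without x V ∩ sameClass w)) ≡⟨ count-without-∩ V (sameClass w) x vx (sameClass⁺ cw≡cx) ⟨
    count (V ∩ sameClass w)                 ≡⟨ agree w ⟩
    count (P ∩ sameClass w)                 ≡⟨ count-without-∩ P (sameClass w) y py (sameClass⁺ (trans cw≡cx cx≡cy)) ⟩
    suc (count (without y P ∩ sameClass w)) ∎)
    where open ≡-Reasoning
  ... | no cw≢cx = begin
    count (without x V ∩ sameClass w) ≡⟨ count-without-∩-outside V (sameClass w) x (sameClass-false cw≢cx) ⟩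
    count (V ∩ sameClass w)           ≡⟨ agree w ⟩
    count (P ∩ sameClass w)           ≡⟨ count-without-∩-outside P (sameClass w) y
                                           (sameClass-false (λ cw≡cy → cw≢cx (trans cw≡cy (sym cx≡cy)))) ⟨
    count (without y P ∩ sameClass w) ∎
    where open ≡-Reasoning

  Members : (Fin n → Bool) → Set
  Members V = Σ (Fin n) (λ x → V x ≡ true)

  record ClassBijection (V P : Fin n → Bool) : Set where
    field
      to               : Members V → Members P
      injective        : ∀ a b → proj₁ (to a) ≡ proj₁ (to b) → proj₁ a ≡ proj₁ b
      surjective       : ∀ y → P y ≡ true → ∃ λ a → proj₁ (to a) ≡ y
      class-preserving : ∀ a → c (proj₁ (to a)) ≡ c (proj₁ a)

  extend : ∀ {V P} x y → V x ≡ true → P y ≡ true → c x ≡ c y →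
    ClassBijection (without x V) (without y P) → ClassBijection V P
  extend {V} {P} x y vx py cx≡cy B = record
    { to = to ; injective = injective ; surjective = surjective ; class-preserving = class-preserving }
    where
    module B = ClassBijection B

    to′ : ∀ z → V z ≡ true → Dec (x ≡ z) → Members P
    to′ z vz (yes _)  = y , py
    to′ z vz (no x≢z) = proj₁ (B.to (z , without⁺ V vz x≢z)) , ∧-conicalˡ _ _ (proj₂ (B.to (z , without⁺ V vz x≢z)))

    to : Members V → Members P
    to (z , vz) = to′ z vz (x ≟ z)

    to-x : ∀ z vz → x ≡ z → proj₁ (to (z , vz)) ≡ y
    to-x z vz x≡z = helper (x ≟ z)
      where
      helper : (d : Dec (x ≡ z)) → proj₁ (to′ z vz d) ≡ y
      helper (yes _)  = refl
      helper (no x≢z) = ⊥-elim (x≢z x≡z)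

    to-other : ∀ z vz (x≢z : x ≢ z) → proj₁ (to (z , vz)) ≡ proj₁ (B.to (z , without⁺ V vz x≢z))
    to-other z vz x≢z = helper (x ≟ z)
      where
      helper : (d : Dec (x ≡ z)) → proj₁ (to′ z vz d) ≡ proj₁ (B.to (z , without⁺ V vz x≢z))
      helper (yes x≡z) = ⊥-elim (x≢z x≡z)
      helper (no _)    = cong (λ pf → proj₁ (B.to (z , pf))) (bool-irrelevant _ _)

    to-other≢y : ∀ z vz → x ≢ z → proj₁ (to (z , vz)) ≢ y
    to-other≢y z vz x≢z eq = without⁻ P (proj₂ (B.to (z , without⁺ V vz x≢z))) (sym (trans (sym (to-other z vz x≢z)) eq))

    injective : ∀ a b → proj₁ (to a) ≡ proj₁ (to b) → proj₁ a ≡ proj₁ b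
    injective (a , va) (b , vb) eq = cases (x ≟ a) (x ≟ b)
      where
      cases : Dec (x ≡ a) → Dec (x ≡ b) → a ≡ b
      cases (yes x≡a) (yes x≡b) = trans (sym x≡a) x≡b
      cases (yes x≡a) (no x≢b)  = ⊥-elim (to-other≢y b vb x≢b (trans (sym eq) (to-x a va x≡a)))
      cases (no x≢a)  (yes x≡b) = ⊥-elim (to-other≢y a va x≢a (trans eq (to-x b vb x≡b)))
      cases (no x≢a)  (no x≢b)  =
        B.injective _ _ (trans (sym (to-other a va x≢a)) (trans eq (to-other b vb x≢b)))

    surjective : ∀ t → P t ≡ true → ∃ λ a → proj₁ (to a) ≡ t
    surjective t pt with y ≟ t
    ... | yes refl = (x , vx) , to-x x vx refl
    ... | no y≢t with B.surjective t (without⁺ P pt y≢t)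
    ...   | (z , vz′) , eq = (z , ∧-conicalˡ _ _ vz′) ,
            trans (to-other z _ x≢z) (trans (cong (λ pf → proj₁ (B.to (z , pf))) (bool-irrelevant _ _)) eq)
      where
      x≢z : x ≢ z
      x≢z = without⁻ V vz′

    class-preserving : ∀ a → c (proj₁ (to a)) ≡ c (proj₁ a)
    class-preserving (z , vz) with x ≟ z
    ... | yes refl = sym cx≡cy
    ... | no _     = B.class-preserving _

  opaque
    classBijection : ∀ V P → ClassCountsAgree V P → ClassBijection V P
    classBijection V P agree = go n V P agree (count≤n V)
      where
      go : ∀ k V P → ClassCountsAgree V P → count V ≤ k → ClassBijection V P
      go k V P agree V≤k with witness-or-empty V
      ... | inj₂ empty = record
        { to               = λ (x , vx) → ⊥-elim (true≢false vx (empty x))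
        ; injective        = λ (x , vx) _ _ → ⊥-elim (true≢false vx (empty x))
        ; surjective       = λ y py → ⊥-elim (no-preimage y py)
        ; class-preserving = λ (x , vx) → ⊥-elim (true≢false vx (empty x)) }
        where
        no-preimage : ∀ y → P y ≡ true → ⊥
        no-preimage y py with count-witness (V ∩ sameClass y)
                                (subst (0 <_) (sym (agree y)) (count-positive _ y (∧-intro py (sameClass⁺ refl))))
        ... | x , e = true≢false (∧-conicalˡ _ _ e) (empty x)
      go zero    V P agree V≤0 | inj₁ (x , vx) = ⊥-elim (<⇒≱ (count-positive V x vx) V≤0)
      go (suc k) V P agree V≤1+k | inj₁ (x , vx)
        with count-witness (P ∩ sameClass x) (subst (0 <_) (agree x) (count-positive _ x (∧-intro vx (sameClass⁺ refl))))
      ... | y , e = extend x y vx py cx≡cy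
                      (go k (without x V) (without y P)
                          (ClassCountsAgree-without V P x y vx py cx≡cy agree)
                          (≤-pred (subst (_≤ suc k) (count-without V x vx) V≤1+k)))
        where
        py : P y ≡ true
        py = ∧-conicalˡ _ _ e
        cx≡cy : c x ≡ c y
        cx≡cy = sameClass⁻ (∧-conicalʳ (P y) _ e)

module PrimePowers {p : ℕ} (p-prime : Prime p) where

  ∣p^j∧∣m⇒≡1 : ∀ j {d m} → ¬ (p ∣ m) → d ∣ p ^ j → d ∣ m → d ≡ 1
  ∣p^j∧∣m⇒≡1 zero    p∤m d∣1    d∣m = ∣1⇒≡1 d∣1
  ∣p^j∧∣m⇒≡1 (suc j) p∤m d∣pp^j d∣m = ∣p^j∧∣m⇒≡1 j p∤m (coprime-divisor d⊥p d∣pp^j) d∣m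
    where
    d⊥p : Coprime _ p
    d⊥p (i∣d , i∣p) with prime⇒irreducible p-prime i∣p
    ... | inj₁ i≡1 = i≡1
    ... | inj₂ refl = ⊥-elim (p∤m (∣-trans i∣d d∣m))

  coprime-p^ : ∀ j {l} → ¬ (p ∣ l) → Coprime l (p ^ j)
  coprime-p^ j p∤l (i∣l , i∣p^j) = ∣p^j∧∣m⇒≡1 j p∤l i∣p^j i∣l

  p-part : ∀ N → 0 < N → ∃ λ k → ∃ λ l → N ≡ p ^ k * l × ¬ (p ∣ l)
  p-part = <-rec _ go
    where
    go : ∀ N → (∀ {M} → M < N → 0 < M → ∃ λ k → ∃ λ l → M ≡ p ^ k * l × ¬ (p ∣ l)) →
         0 < N → ∃ λ k → ∃ λ l → N ≡ p ^ k * l × ¬ (p ∣ l)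
    go N rec N>0 with p ∣? N
    ... | no p∤N = 0 , N , sym (*-identityˡ N) , p∤N
    ... | yes (divides q refl) with rec q<qp q>0
      where
      q>0 : 0 < q
      q>0 = >-nonZero⁻¹ q {{m*n≢0⇒m≢0 q {{>-nonZero N>0}}}}
      q<qp : q < q * p
      q<qp = subst (_< q * p) (*-identityʳ q)
               (*-monoʳ-< q {{>-nonZero q>0}} (nonTrivial⇒n>1 p {{prime⇒nonTrivial p-prime}}))
    ... | k , l , q≡p^k*l , p∤l =
      suc k , l , trans (cong (_* p) q≡p^k*l) (trans (*-comm _ p) (sym (*-assoc p (p ^ k) l))) , p∤l

least : {P : ℕ → Set} → (∀ k → Dec (P k)) → ∀ {t} → P t →
  ∃ λ s → s ≤ t × P s × (∀ r → r < s → ¬ P r)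
least {P} P? {t} Pt with search (suc t)
  where
  search : ∀ m → (∀ s → s < m → ¬ P s) ⊎ (∃ λ s → s < m × P s × (∀ r → r < s → ¬ P r))
  search zero = inj₁ (λ s ())
  search (suc m) with search m
  ... | inj₂ (s , s<m , Ps , below) = inj₂ (s , m<n⇒m<1+n s<m , Ps , below)
  ... | inj₁ none with P? m
  ...   | yes Pm = inj₂ (m , ≤-refl , Pm , none)
  ...   | no ¬Pm = inj₁ λ s s<1+m → case m≤n⇒m<n∨m≡n (≤-pred s<1+m) of λ
                      { (inj₁ s<m) → none s s<m ; (inj₂ refl) → ¬Pm }
... | inj₁ none = ⊥-elim (none t ≤-refl Pt)
... | inj₂ (s , s<1+t , Ps , below) = s , ≤-pred s<1+t , Ps , below

∣-by-minimality : ∀ {Q : ℕ → Set} d .{{_ : NonZero d}} a →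
  (∀ r → 0 < r → r < d → ¬ Q r) → Q (a % d) → d ∣ a
∣-by-minimality {Q} d a below Q[a%d] with a % d in a%d≡
... | zero  = m%n≡0⇒n∣m a d a%d≡
... | suc r = ⊥-elim (below (suc r) (s≤s z≤n) (subst (_< d) a%d≡ (m%n<n a d)) Q[a%d])

module GroupTheory {n : ℕ} (G : FinGroup n) where

  open Counting

  group : Group 0ℓ 0ℓ
  group = record { _≈_ = _≡_ ; isGroup = FinGroup.isGroup G }

  open Group group public using (_∙_; ε; _⁻¹; assoc; identityˡ; identityʳ; inverseˡ; inverseʳ)
  open Algebra.Properties.Group group public
    using (∙-cancelˡ; \\-leftDividesˡ; \\-leftDividesʳ; //-rightDividesˡ; //-rightDividesʳ;
           inverseʳ-unique; ε⁻¹≈ε; ⁻¹-involutive; ⁻¹-anti-homo-∙)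

  infixr 8 _^ᴳ_
  _^ᴳ_ : Fin n → ℕ → Fin n
  _^ᴳ_ = powℕ G

  ^ᴳ-+ : ∀ z a b → z ^ᴳ (a + b) ≡ z ^ᴳ a ∙ z ^ᴳ b
  ^ᴳ-+ z zero    b = sym (identityˡ _)
  ^ᴳ-+ z (suc a) b = trans (cong (z ∙_) (^ᴳ-+ z a b)) (sym (assoc _ _ _))

  ^ᴳ-1 : ∀ z → z ^ᴳ 1 ≡ z
  ^ᴳ-1 = identityʳ

  ^ᴳ-* : ∀ z a b → z ^ᴳ (b * a) ≡ (z ^ᴳ a) ^ᴳ b
  ^ᴳ-* z a zero    = refl
  ^ᴳ-* z a (suc b) = trans (^ᴳ-+ z a (b * a)) (cong (z ^ᴳ a ∙_) (^ᴳ-* z a b))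

  ε^ᴳ : ∀ k → ε ^ᴳ k ≡ ε
  ε^ᴳ zero    = refl
  ε^ᴳ (suc k) = trans (identityˡ _) (ε^ᴳ k)

  ⁻¹^ᴳ : ∀ z k → (z ⁻¹) ^ᴳ k ≡ (z ^ᴳ k) ⁻¹
  ⁻¹^ᴳ z zero    = sym ε⁻¹≈ε
  ⁻¹^ᴳ z (suc k) = begin
    z ⁻¹ ∙ (z ⁻¹) ^ᴳ k    ≡⟨ cong (z ⁻¹ ∙_) (⁻¹^ᴳ z k) ⟩
    z ⁻¹ ∙ (z ^ᴳ k) ⁻¹    ≡⟨ ⁻¹-anti-homo-∙ (z ^ᴳ k) z ⟨
    (z ^ᴳ k ∙ z) ⁻¹       ≡⟨ cong (λ t → (z ^ᴳ k ∙ t) ⁻¹) (^ᴳ-1 z) ⟨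
    (z ^ᴳ k ∙ z ^ᴳ 1) ⁻¹  ≡⟨ cong _⁻¹ (^ᴳ-+ z k 1) ⟨
    (z ^ᴳ (k + 1)) ⁻¹     ≡⟨ cong (λ t → (z ^ᴳ t) ⁻¹) (+-comm k 1) ⟩
    (z ^ᴳ suc k) ⁻¹       ∎
    where open ≡-Reasoning

  private
    Period : Fin n → ℕ → Set
    Period z t = 0 < t × z ^ᴳ t ≡ ε

    period? : ∀ z t → Dec (Period z t)
    period? z zero    = no λ ()
    period? z (suc t) with z ^ᴳ suc t ≟ ε
    ... | yes e  = yes (s≤s z≤n , e)
    ... | no z^t≢ε = no (z^t≢ε ∘ proj₂)

    -- two of the powers z⁰, …, zⁿ coincide
    some-period : ∀ z → ∃ λ t → t ≤ n × Period z t
    some-period z with pigeonhole (n<1+n n) (λ (i : Fin (suc n)) → z ^ᴳ toℕ i)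
    ... | i , j , i<j , zⁱ≡zʲ =
      toℕ j ∸ toℕ i , ≤-trans (m∸n≤m (toℕ j) (toℕ i)) (≤-pred (toℕ<n j)) , m<n⇒0<n∸m i<j ,
      ∙-cancelˡ (z ^ᴳ toℕ i) _ _ (begin
        z ^ᴳ toℕ i ∙ z ^ᴳ (toℕ j ∸ toℕ i) ≡⟨ ^ᴳ-+ z (toℕ i) _ ⟨
        z ^ᴳ (toℕ i + (toℕ j ∸ toℕ i))    ≡⟨ cong (z ^ᴳ_) (m+[n∸m]≡n (<⇒≤ i<j)) ⟩
        z ^ᴳ toℕ j                        ≡⟨ zⁱ≡zʲ ⟨
        z ^ᴳ toℕ i                        ≡⟨ identityʳ _ ⟨
        z ^ᴳ toℕ i ∙ ε                    ∎)
      where open ≡-Reasoning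

    least-period : ∀ z → ∃ λ t → t ≤ n × Period z t × (∀ s → s < t → ¬ Period z s)
    least-period z with some-period z
    ... | t , t≤n , period with least (period? z) period
    ...   | s , s≤t , rest = s , ≤-trans s≤t t≤n , rest

  -- Defined by exhaustive search; opaque so that the type checker never unfolds the search.
  opaque
    order : Fin n → ℕ
    order z = proj₁ (least-period z)

    order≤n : ∀ z → order z ≤ n
    order≤n z = proj₁ (proj₂ (least-period z))

    instance
      order≢0 : ∀ {z} → NonZero (order z)
      order≢0 {z} = >-nonZero (proj₁ (proj₁ (proj₂ (proj₂ (least-period z)))))

    ^ᴳ-order : ∀ z → z ^ᴳ order z ≡ ε
    ^ᴳ-order z = proj₂ (proj₁ (proj₂ (proj₂ (least-period z))))

    order-minimal : ∀ z s → 0 < s → s < order z → z ^ᴳ s ≢ ε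
    order-minimal z s s>0 s<ord zˢ≡ε = proj₂ (proj₂ (proj₂ (least-period z))) s s<ord (s>0 , zˢ≡ε)

  ^ᴳ-multiple-of-order : ∀ z q → z ^ᴳ (q * order z) ≡ ε
  ^ᴳ-multiple-of-order z q = trans (^ᴳ-* z (order z) q) (trans (cong (_^ᴳ q) (^ᴳ-order z)) (ε^ᴳ q))

  ^ᴳ-% : ∀ z a → z ^ᴳ a ≡ z ^ᴳ (a % order z)
  ^ᴳ-% z a = begin
    z ^ᴳ a                                         ≡⟨ cong (z ^ᴳ_) (m≡m%n+[m/n]*n a (order z)) ⟩
    z ^ᴳ (a % order z + (a / order z) * order z)   ≡⟨ ^ᴳ-+ z (a % order z) _ ⟩
    z ^ᴳ (a % order z) ∙ z ^ᴳ ((a / order z) * order z)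
                                                   ≡⟨ cong (z ^ᴳ (a % order z) ∙_) (^ᴳ-multiple-of-order z (a / order z)) ⟩
    z ^ᴳ (a % order z) ∙ ε                         ≡⟨ identityʳ _ ⟩
    z ^ᴳ (a % order z)                             ∎
    where open ≡-Reasoning

  ^ᴳ≡ε⇒order∣ : ∀ z a → z ^ᴳ a ≡ ε → order z ∣ a
  ^ᴳ≡ε⇒order∣ z a zᵃ≡ε = ∣-by-minimality (order z) a (order-minimal z) (trans (sym (^ᴳ-% z a)) zᵃ≡ε)

  order∣⇒^ᴳ≡ε : ∀ z a → order z ∣ a → z ^ᴳ a ≡ ε
  order∣⇒^ᴳ≡ε z .(q * order z) (divides q refl) = ^ᴳ-multiple-of-order z q

  ^ᴳ-injective-≤ : ∀ z {a b} → a ≤ b → b < order z → z ^ᴳ a ≡ z ^ᴳ b → a ≡ b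
  ^ᴳ-injective-≤ z {a} {b} a≤b b<ord zᵃ≡zᵇ = ≤-antisym a≤b (m∸n≡0⇒m≤n b∸a≡0)
    where
    zᵇ⁻ᵃ≡ε : z ^ᴳ (b ∸ a) ≡ ε
    zᵇ⁻ᵃ≡ε = ∙-cancelˡ (z ^ᴳ a) _ _ (trans (sym (^ᴳ-+ z a (b ∸ a)))
               (trans (cong (z ^ᴳ_) (m+[n∸m]≡n a≤b)) (trans (sym zᵃ≡zᵇ) (sym (identityʳ _)))))
    b∸a≡0 : b ∸ a ≡ 0
    b∸a≡0 = trans (sym (m<n⇒m%n≡m (≤-<-trans (m∸n≤m b a) b<ord)))
                  (n∣m⇒m%n≡0 (b ∸ a) (order z) (^ᴳ≡ε⇒order∣ z (b ∸ a) zᵇ⁻ᵃ≡ε))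

  ^ᴳ-injective : ∀ z {a b} → a < order z → b < order z → z ^ᴳ a ≡ z ^ᴳ b → a ≡ b
  ^ᴳ-injective z {a} {b} a<ord b<ord zᵃ≡zᵇ with ≤-total a b
  ... | inj₁ a≤b = ^ᴳ-injective-≤ z a≤b b<ord zᵃ≡zᵇ
  ... | inj₂ b≤a = sym (^ᴳ-injective-≤ z b≤a a<ord (sym zᵃ≡zᵇ))

  opaque
    ⟨_⟩ : Fin n → Fin n → Bool
    ⟨ z ⟩ x = does (any? (λ (i : Fin n) → x ≟ z ^ᴳ toℕ i))

    ^ᴳ∈⟨⟩ : ∀ z a → ⟨ z ⟩ (z ^ᴳ a) ≡ true
    ^ᴳ∈⟨⟩ z a with any? (λ (i : Fin n) → z ^ᴳ a ≟ z ^ᴳ toℕ i)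
    ... | yes _ = refl
    ... | no ∄i = ⊥-elim (∄i (fromℕ< r<n , trans (^ᴳ-% z a) (cong (z ^ᴳ_) (sym (toℕ-fromℕ< r<n)))))
      where
      r<n : a % order z < n
      r<n = ≤-trans (m%n<n a (order z)) (order≤n z)

    ∈⟨⟩⇒^ᴳ : ∀ z x → ⟨ z ⟩ x ≡ true → ∃ λ a → a < order z × x ≡ z ^ᴳ a
    ∈⟨⟩⇒^ᴳ z x e with any? (λ (i : Fin n) → x ≟ z ^ᴳ toℕ i)
    ... | yes (i , x≡zⁱ) = toℕ i % order z , m%n<n (toℕ i) (order z) , trans x≡zⁱ (^ᴳ-% z (toℕ i))

  ⟨⟩-self : ∀ z → ⟨ z ⟩ z ≡ true
  ⟨⟩-self z = subst (λ t → ⟨ z ⟩ t ≡ true) (^ᴳ-1 z) (^ᴳ∈⟨⟩ z 1)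

  ⟨⟩-ε : ∀ z → ⟨ z ⟩ ε ≡ true
  ⟨⟩-ε z = ^ᴳ∈⟨⟩ z 0

  ⟨⟩-trans : ∀ w z x → ⟨ w ⟩ z ≡ true → ⟨ z ⟩ x ≡ true → ⟨ w ⟩ x ≡ true
  ⟨⟩-trans w z x z∈ x∈ with ∈⟨⟩⇒^ᴳ w z z∈ | ∈⟨⟩⇒^ᴳ z x x∈
  ... | a , _ , refl | b , _ , refl = subst (λ t → ⟨ w ⟩ t ≡ true) (^ᴳ-* w a b) (^ᴳ∈⟨⟩ w (b * a))

  ⟨⟩-∙ : ∀ z x y → ⟨ z ⟩ x ≡ true → ⟨ z ⟩ y ≡ true → ⟨ z ⟩ (x ∙ y) ≡ true
  ⟨⟩-∙ z x y x∈ y∈ with ∈⟨⟩⇒^ᴳ z x x∈ | ∈⟨⟩⇒^ᴳ z y y∈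
  ... | a , _ , refl | b , _ , refl = subst (λ t → ⟨ z ⟩ t ≡ true) (^ᴳ-+ z a b) (^ᴳ∈⟨⟩ z (a + b))

  ⁻¹≡^ᴳpred-order : ∀ z → z ⁻¹ ≡ z ^ᴳ pred (order z)
  ⁻¹≡^ᴳpred-order z = sym (inverseʳ-unique z _ (trans (cong (z ^ᴳ_) (suc-pred (order z))) (^ᴳ-order z)))

  ^ᴳ-⁻¹ : ∀ z a → (z ^ᴳ a) ⁻¹ ≡ z ^ᴳ (a * pred (order z))
  ^ᴳ-⁻¹ z a = begin
    (z ^ᴳ a) ⁻¹              ≡⟨ ⁻¹^ᴳ z a ⟨
    (z ⁻¹) ^ᴳ a              ≡⟨ cong (_^ᴳ a) (⁻¹≡^ᴳpred-order z) ⟩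
    (z ^ᴳ pred (order z)) ^ᴳ a ≡⟨ ^ᴳ-* z (pred (order z)) a ⟨
    z ^ᴳ (a * pred (order z)) ∎
    where open ≡-Reasoning

  ^ᴳ⁻¹∈⟨⟩ : ∀ z a → ⟨ z ⟩ ((z ^ᴳ a) ⁻¹) ≡ true
  ^ᴳ⁻¹∈⟨⟩ z a = subst (λ t → ⟨ z ⟩ t ≡ true) (sym (^ᴳ-⁻¹ z a)) (^ᴳ∈⟨⟩ z (a * pred (order z)))

  ⟨⟩-⁻¹ : ∀ z x → ⟨ z ⟩ x ≡ true → ⟨ z ⟩ (x ⁻¹) ≡ true
  ⟨⟩-⁻¹ z x x∈ with ∈⟨⟩⇒^ᴳ z x x∈
  ... | a , _ , refl = ^ᴳ⁻¹∈⟨⟩ z a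

  InCyclic⇒∈⟨⟩ : ∀ x z → InCyclic G x z → ⟨ z ⟩ x ≡ true
  InCyclic⇒∈⟨⟩ x z (pos a , refl)    = ^ᴳ∈⟨⟩ z a
  InCyclic⇒∈⟨⟩ x z (-[1+ a ] , refl) = subst (λ t → ⟨ z ⟩ t ≡ true) (sym (⁻¹^ᴳ z (suc a))) (^ᴳ⁻¹∈⟨⟩ z (suc a))

  ∈⟨⟩⇒InCyclic : ∀ x z → ⟨ z ⟩ x ≡ true → InCyclic G x z
  ∈⟨⟩⇒InCyclic x z x∈ with ∈⟨⟩⇒^ᴳ z x x∈
  ... | a , _ , x≡zᵃ = pos a , x≡zᵃ

  count⟨⟩≡order : ∀ z → count ⟨ z ⟩ ≡ order z
  count⟨⟩≡order z = count-image (λ i → z ^ᴳ toℕ i) injective ⟨ z ⟩ onto (λ i → ^ᴳ∈⟨⟩ z (toℕ i))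
    where
    injective : ∀ i j → z ^ᴳ toℕ i ≡ z ^ᴳ toℕ j → i ≡ j
    injective i j e = toℕ-injective (^ᴳ-injective z (toℕ<n i) (toℕ<n j) e)
    onto : ∀ y → ⟨ z ⟩ y ≡ true → ∃ λ i → z ^ᴳ toℕ i ≡ y
    onto y y∈ with ∈⟨⟩⇒^ᴳ z y y∈
    ... | a , a<ord , y≡zᵃ = fromℕ< a<ord , trans (cong (z ^ᴳ_) (toℕ-fromℕ< a<ord)) (sym y≡zᵃ)

  record Subgroup (H : Fin n → Bool) : Set where
    field
      ε∈  : H ε ≡ true
      ∙∈  : ∀ x y → H x ≡ true → H y ≡ true → H (x ∙ y) ≡ true
      ⁻¹∈ : ∀ x → H x ≡ true → H (x ⁻¹) ≡ true

    ^ᴳ∈ : ∀ x k → H x ≡ true → H (x ^ᴳ k) ≡ true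
    ^ᴳ∈ x zero    hx = ε∈
    ^ᴳ∈ x (suc k) hx = ∙∈ _ _ hx (^ᴳ∈ x k hx)

  ⟨⟩-subgroup : ∀ z → Subgroup ⟨ z ⟩
  ⟨⟩-subgroup z = record { ε∈ = ⟨⟩-ε z ; ∙∈ = ⟨⟩-∙ z ; ⁻¹∈ = ⟨⟩-⁻¹ z }

  ⟨⟩⊆ : ∀ {H} → Subgroup H → ∀ x → H x ≡ true → ∀ y → ⟨ x ⟩ y ≡ true → H y ≡ true
  ⟨⟩⊆ sH x hx y y∈ with ∈⟨⟩⇒^ᴳ x y y∈
  ... | a , _ , refl = Subgroup.^ᴳ∈ sH x a hx

  count-translate : ∀ (H : Fin n → Bool) x → count (λ y → H (x ∙ y)) ≡ count H
  count-translate H x = count-permute H (x ∙_) (x ⁻¹ ∙_) (\\-leftDividesˡ x) (\\-leftDividesʳ x)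

  lagrange : ∀ {H K} → Subgroup H → Subgroup K → (∀ x → H x ≡ true → K x ≡ true) → count H ∣ count K
  lagrange {H} {K} sH sK H⊆K =
    Cosets.classSize∣count (count H) (λ x → count-translate H (x ⁻¹)) K K-saturated
    where
    open Subgroup
    sameCoset : Fin n → Fin n → Bool
    sameCoset x y = H (x ⁻¹ ∙ y)
    sameCoset-refl : ∀ x → sameCoset x x ≡ true
    sameCoset-refl x = subst (λ t → H t ≡ true) (sym (inverseˡ x)) (ε∈ sH)
    sameCoset-trans : ∀ x y → sameCoset x y ≡ true → ∀ z → sameCoset y z ≡ sameCoset x z
    sameCoset-trans x y x~y z = bool-ext
      (λ y~z → subst (λ t → H t ≡ true) (x⁻¹y∙y⁻¹z x y z) (∙∈ sH _ _ x~y y~z))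
      (λ x~z → subst (λ t → H t ≡ true) (x⁻¹y⁻¹∙x⁻¹z x y z) (∙∈ sH _ _ (⁻¹∈ sH _ x~y) x~z))
      where
      x⁻¹y∙y⁻¹z : ∀ x y z → (x ⁻¹ ∙ y) ∙ (y ⁻¹ ∙ z) ≡ x ⁻¹ ∙ z
      x⁻¹y∙y⁻¹z x y z = trans (assoc _ _ _) (cong (x ⁻¹ ∙_) (\\-leftDividesˡ y z))
      x⁻¹y⁻¹∙x⁻¹z : ∀ x y z → (x ⁻¹ ∙ y) ⁻¹ ∙ (x ⁻¹ ∙ z) ≡ y ⁻¹ ∙ z
      x⁻¹y⁻¹∙x⁻¹z x y z = begin
        (x ⁻¹ ∙ y) ⁻¹ ∙ (x ⁻¹ ∙ z)      ≡⟨ cong (_∙ (x ⁻¹ ∙ z)) (⁻¹-anti-homo-∙ (x ⁻¹) y) ⟩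
        (y ⁻¹ ∙ x ⁻¹ ⁻¹) ∙ (x ⁻¹ ∙ z)   ≡⟨ cong (λ t → (y ⁻¹ ∙ t) ∙ (x ⁻¹ ∙ z)) (⁻¹-involutive x) ⟩
        (y ⁻¹ ∙ x) ∙ (x ⁻¹ ∙ z)         ≡⟨ assoc _ _ _ ⟩
        y ⁻¹ ∙ (x ∙ (x ⁻¹ ∙ z))         ≡⟨ cong (y ⁻¹ ∙_) (\\-leftDividesˡ x z) ⟩
        y ⁻¹ ∙ z                        ∎
        where open ≡-Reasoning
    module Cosets = Classes sameCoset sameCoset-refl sameCoset-trans
    K-saturated : Cosets.Saturated K
    K-saturated x y kx x~y = subst (λ t → K t ≡ true) (\\-leftDividesˡ x y) (∙∈ sK _ _ kx (H⊆K _ x~y))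

  order∣count : ∀ {H} → Subgroup H → ∀ x → H x ≡ true → order x ∣ count H
  order∣count sH x hx = subst (_∣ _) (count⟨⟩≡order x) (lagrange (⟨⟩-subgroup x) sH (⟨⟩⊆ sH x hx))

  opaque
    least-power-in : ∀ {H} → Subgroup H → ∀ z →
      ∃ λ d → 0 < d × H (z ^ᴳ d) ≡ true × (∀ r → 0 < r → r < d → H (z ^ᴳ r) ≢ true)
    least-power-in {H} sH z with least inH? (>-nonZero⁻¹ (order z) , z^order∈H)
      where
      inH? : ∀ d → Dec (0 < d × H (z ^ᴳ d) ≡ true)
      inH? zero    = no λ ()
      inH? (suc d) with H (z ^ᴳ suc d) Boolₚ.≟ true
      ... | yes e  = yes (s≤s z≤n , e)
      ... | no ¬e = no (¬e ∘ proj₂)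
      z^order∈H : H (z ^ᴳ order z) ≡ true
      z^order∈H = subst (λ t → H t ≡ true) (sym (^ᴳ-order z)) (Subgroup.ε∈ sH)
    ... | d , _ , (d>0 , zᵈ∈H) , below = d , d>0 , zᵈ∈H , λ r r>0 r<d zʳ∈H → below r r<d (r>0 , zʳ∈H)

  -- H = ⟨ z ^ᴳ d ⟩ for the least d > 0 with z ^ᴳ d ∈ H
  subgroup-of-cyclic : ∀ {H} z → Subgroup H → (∀ x → H x ≡ true → ⟨ z ⟩ x ≡ true) →
    ∃ λ u → ∀ x → H x ≡ ⟨ u ⟩ x
  subgroup-of-cyclic {H} z sH H⊆⟨z⟩ with least-power-in sH z
  ... | d , d>0 , zᵈ∈H , below = z ^ᴳ d , λ x → bool-ext (H⊆⟨zᵈ⟩ x) (⟨⟩⊆ sH (z ^ᴳ d) zᵈ∈H x)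
    where
    open Subgroup sH
    instance
      d≢0 : NonZero d
      d≢0 = >-nonZero d>0
    H⊆⟨zᵈ⟩ : ∀ x → H x ≡ true → ⟨ z ^ᴳ d ⟩ x ≡ true
    H⊆⟨zᵈ⟩ x hx with ∈⟨⟩⇒^ᴳ z x (H⊆⟨z⟩ x hx)
    ... | a , _ , refl with ∣-by-minimality d a below zʳ∈H
      where
      zᵃ≡zʳ∙zᵈ^q : z ^ᴳ a ≡ z ^ᴳ (a % d) ∙ (z ^ᴳ d) ^ᴳ (a / d)
      zᵃ≡zʳ∙zᵈ^q = trans (cong (z ^ᴳ_) (m≡m%n+[m/n]*n a d))
                         (trans (^ᴳ-+ z (a % d) _) (cong (z ^ᴳ (a % d) ∙_) (^ᴳ-* z d (a / d))))
      zʳ∈H : H (z ^ᴳ (a % d)) ≡ true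
      zʳ∈H = subst (λ t → H t ≡ true) (trans (cong (_∙ ((z ^ᴳ d) ^ᴳ (a / d)) ⁻¹) zᵃ≡zʳ∙zᵈ^q) (//-rightDividesʳ _ _))
               (∙∈ _ _ hx (⁻¹∈ _ (^ᴳ∈ (z ^ᴳ d) (a / d) zᵈ∈H)))
    ...   | divides q refl = subst (λ t → ⟨ z ^ᴳ d ⟩ t ≡ true) (sym (^ᴳ-* z d q)) (^ᴳ∈⟨⟩ (z ^ᴳ d) q)

module MaximalCyclic {n : ℕ} (G : FinGroup n) where

  open Counting
  open SubsetsAsPredicates
  open GroupTheory G

  Maximal : Fin n → Set
  Maximal z = ∀ w → ⟨ w ⟩ z ≡ true → ⟨ z ⟩ w ≡ true

  private
    absorbs? : ∀ z w → Dec (⟨ w ⟩ z ≡ true → ⟨ z ⟩ w ≡ true)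
    absorbs? z w = (⟨ w ⟩ z Boolₚ.≟ true) →-dec (⟨ z ⟩ w Boolₚ.≟ true)

  maximal? : ∀ z → Dec (Maximal z)
  maximal? z = all? (absorbs? z)

  ⟨⟩⊂⇒order< : ∀ z w → ⟨ w ⟩ z ≡ true → ⟨ z ⟩ w ≢ true → order z < order w
  ⟨⟩⊂⇒order< z w z∈⟨w⟩ w∉⟨z⟩ = ≰⇒> λ w≤z → w∉⟨z⟩ (⊆∧count≤⇒⊇ ⟨ z ⟩ ⟨ w ⟩ (λ y → ⟨⟩-trans w z y z∈⟨w⟩)
    (subst₂ _≤_ (sym (count⟨⟩≡order w)) (sym (count⟨⟩≡order z)) w≤z) w (⟨⟩-self w))

  -- Each step replaces ⟨ z ⟩ by a strictly larger cyclic subgroup, so n ∸ order z decreases.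
  maximal-above : ∀ x → ∃ λ z → Maximal z × ⟨ z ⟩ x ≡ true
  maximal-above x = go (suc n) x (s≤s (m∸n≤m n (order x))) (⟨⟩-self x)
    where
    go : ∀ k z → n ∸ order z < k → ⟨ z ⟩ x ≡ true → ∃ λ z → Maximal z × ⟨ z ⟩ x ≡ true
    go k z bound x∈ with maximal? z
    ... | yes maximal = z , maximal , x∈
    go zero    z () x∈ | no _
    go (suc k) z bound x∈ | no ¬maximal with ¬∀⟶∃¬ n _ (absorbs? z) ¬maximal
    ... | w , ¬absorbs = go k w bound′ (⟨⟩-trans w z x z∈⟨w⟩ x∈)
      where
      z∈⟨w⟩ : ⟨ w ⟩ z ≡ true
      z∈⟨w⟩ with ⟨ w ⟩ z
      ... | true  = refl
      ... | false = ⊥-elim (¬absorbs (λ ()))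
      bound′ : n ∸ order w < k
      bound′ = ≤-trans (∸-monoʳ-< (⟨⟩⊂⇒order< z w z∈⟨w⟩ (λ w∈ → ¬absorbs (λ _ → w∈))) (order≤n w)) (≤-pred bound)

  Adj⁺ : ∀ {x y} z → x ≢ y → ⟨ z ⟩ x ≡ true → ⟨ z ⟩ y ≡ true → EPGAdj G x y
  Adj⁺ {x} {y} z x≢y x∈ y∈ = x≢y , z , ∈⟨⟩⇒InCyclic x z x∈ , ∈⟨⟩⇒InCyclic y z y∈

  Adj⁻ : ∀ {x y} → EPGAdj G x y → ∃ λ z → Maximal z × ⟨ z ⟩ x ≡ true × ⟨ z ⟩ y ≡ true
  Adj⁻ {x} {y} (_ , w , x∈⟨w⟩ , y∈⟨w⟩) with maximal-above w
  ... | z , maximal , w∈⟨z⟩ =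
    z , maximal , ⟨⟩-trans z w x w∈⟨z⟩ (InCyclic⇒∈⟨⟩ x w x∈⟨w⟩) , ⟨⟩-trans z w y w∈⟨z⟩ (InCyclic⇒∈⟨⟩ y w y∈⟨w⟩)

  ⟨_⟩ₛ : Fin n → Subset n
  ⟨ z ⟩ₛ = tabulate ⟨ z ⟩

  maximalClique : ∀ z → Maximal z → IsMaximalClique (EPGAdj G) ⟨ z ⟩ₛ
  maximalClique z maximal = clique , λ D D-clique ⟨z⟩⊆D → ⊆-antisym (D⊆⟨z⟩ D D-clique ⟨z⟩⊆D) (⟨z⟩⊆D _)
    where
    clique : IsClique (EPGAdj G) ⟨ z ⟩ₛ
    clique x y x∈ y∈ x≢y = Adj⁺ z x≢y (∈-tabulate⁻ x∈) (∈-tabulate⁻ y∈)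
    D⊆⟨z⟩ : ∀ D → IsClique (EPGAdj G) D → (∀ x → x ∈ ⟨ z ⟩ₛ → x ∈ D) → ∀ {x} → x ∈ D → x ∈ ⟨ z ⟩ₛ
    D⊆⟨z⟩ D D-clique ⟨z⟩⊆D {x} x∈D with x ≟ z
    ... | yes refl = ∈-tabulate⁺ (⟨⟩-self z)
    ... | no x≢z with D-clique x z x∈D (⟨z⟩⊆D z (∈-tabulate⁺ (⟨⟩-self z))) x≢z
    ...   | _ , w , x∈⟨w⟩ , z∈⟨w⟩ =
      ∈-tabulate⁺ (⟨⟩-trans z w x (maximal w (InCyclic⇒∈⟨⟩ z w z∈⟨w⟩)) (InCyclic⇒∈⟨⟩ x w x∈⟨w⟩))

  maximal-through? : ∀ w z → Dec (Maximal z × ⟨ z ⟩ w ≡ true)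
  maximal-through? w z = maximal? z ×-dec (⟨ z ⟩ w Boolₚ.≟ true)

  opaque
    -- One maximal cyclic subgroup through w is listed twice, making the family visibly nonempty.
    closure : Fin n → Subset n
    closure w = ⋂ (⟨ proj₁ (maximal-above w) ⟩ₛ ∷ map ⟨_⟩ₛ (filter (maximal-through? w) (allFin n)))

    closure∈𝓑 : ∀ w → InB (EPGAdj G) (closure w)
    closure∈𝓑 w = _ , _ , maximalClique _ (proj₁ (proj₂ (maximal-above w))) ,
      Allₚ.map⁺ (All.map (λ (maximal , _) → maximalClique _ maximal)
                         (Allₚ.all-filter (maximal-through? w) (allFin n))) ,
      refl

    ∈closure⁺ : ∀ {w x} → (∀ z → Maximal z → ⟨ z ⟩ w ≡ true → ⟨ z ⟩ x ≡ true) → x ∈ closure w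
    ∈closure⁺ {w} {x} h with maximal-above w
    ... | z₀ , maximal₀ , w∈⟨z₀⟩ = ∈⋂⁺ (∈-tabulate⁺ (h z₀ maximal₀ w∈⟨z₀⟩) ∷ Allₚ.map⁺ (All.tabulate through))
      where
      through : ∀ {z} → z Listₘ.∈ filter (maximal-through? w) (allFin n) → x ∈ ⟨ z ⟩ₛ
      through z∈ with proj₂ (Listₚ.∈-filter⁻ (maximal-through? w) {xs = allFin n} z∈)
      ... | maximal , w∈⟨z⟩ = ∈-tabulate⁺ (h _ maximal w∈⟨z⟩)

    ∈closure⁻ : ∀ {w x} → x ∈ closure w → ∀ z → Maximal z → ⟨ z ⟩ w ≡ true → ⟨ z ⟩ x ≡ true
    ∈closure⁻ {w} x∈ z maximal w∈⟨z⟩ with ∈⋂⁻ (⟨ proj₁ (maximal-above w) ⟩ₛ ∷ _) x∈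
    ... | _ ∷ x∈through = ∈-tabulate⁻ (All.lookup (Allₚ.map⁻ x∈through)
                            (Listₚ.∈-filter⁺ (maximal-through? w) (Listₚ.∈-allFin z) (maximal , w∈⟨z⟩)))

  closure-self : ∀ w → w ∈ closure w
  closure-self w = ∈closure⁺ (λ _ _ w∈ → w∈)

  closure-mono : ∀ {w x} → x ∈ closure w → ∀ {y} → y ∈ closure x → y ∈ closure w
  closure-mono x∈ y∈ = ∈closure⁺ λ z maximal w∈⟨z⟩ → ∈closure⁻ y∈ z maximal (∈closure⁻ x∈ z maximal w∈⟨z⟩)

  closure-subgroup : ∀ w → Subgroup (lookup (closure w))
  closure-subgroup w = record
    { ε∈  = ∈⇒lookup (∈closure⁺ λ z _ _ → ⟨⟩-ε z)
    ; ∙∈  = λ x y x∈ y∈ → ∈⇒lookup (∈closure⁺ λ z maximal w∈ →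
              ⟨⟩-∙ z x y (∈closure⁻ (lookup⇒∈ x∈) z maximal w∈) (∈closure⁻ (lookup⇒∈ y∈) z maximal w∈))
    ; ⁻¹∈ = λ x x∈ → ∈⇒lookup (∈closure⁺ λ z maximal w∈ → ⟨⟩-⁻¹ z x (∈closure⁻ (lookup⇒∈ x∈) z maximal w∈)) }

  closure-cyclic : ∀ w → ∃ λ u → ∀ x → lookup (closure w) x ≡ ⟨ u ⟩ x
  closure-cyclic w = subgroup-of-cyclic z₀ (closure-subgroup w) (λ x x∈ → ∈closure⁻ (lookup⇒∈ x∈) z₀ maximal₀ w∈⟨z₀⟩)
    where
    z₀ : Fin n
    z₀ = proj₁ (maximal-above w)
    maximal₀ : Maximal z₀
    maximal₀ = proj₁ (proj₂ (maximal-above w))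
    w∈⟨z₀⟩ : ⟨ z₀ ⟩ w ≡ true
    w∈⟨z₀⟩ = proj₂ (proj₂ (maximal-above w))

  closure≡⇒maximal-through : ∀ {x y} → closure x ≡ closure y → ∀ z → Maximal z → ⟨ z ⟩ x ≡ true → ⟨ z ⟩ y ≡ true
  closure≡⇒maximal-through {y = y} eq = ∈closure⁻ (subst (y ∈_) (sym eq) (closure-self y))

module NormalSylow {n : ℕ} (G : FinGroup n) {p : ℕ} (p-prime : Prime p)
  {P : Fin n → Bool} (P-subgroup : GroupTheory.Subgroup G P) {a m : ℕ}
  (|P|≡p^a : Counting.count P ≡ p ^ a) (n≡p^a*m : n ≡ p ^ a * m) (p∤m : ¬ (p ∣ m))
  (normal : ∀ g x → P x ≡ true → P (GroupTheory._∙_ G (GroupTheory._⁻¹ G g) (GroupTheory._∙_ G x g)) ≡ true)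
  where

  open Counting
  open GroupTheory G
  open Subgroup P-subgroup
  open PrimePowers p-prime

  ∈P⇒^p^a≡ε : ∀ x → P x ≡ true → x ^ᴳ (p ^ a) ≡ ε
  ∈P⇒^p^a≡ε x x∈P = order∣⇒^ᴳ≡ε x (p ^ a) (subst (order x ∣_) |P|≡p^a (order∣count P-subgroup x x∈P))

  -- Let s be least with gˢ ∈ P. The cosets gⁱP (i < s) are disjoint and, P being normal,
  -- their union K is a subgroup of order s·pᵃ; Lagrange gives s ∣ m, while gᵖʲ = ε gives s ∣ pʲ.
  module _ (g : Fin n) (j : ℕ) (g^p^j≡ε : g ^ᴳ (p ^ j) ≡ ε) where

    private
      s : ℕ
      s = proj₁ (least-power-in P-subgroup g)

      s>0 : 0 < s
      s>0 = proj₁ (proj₂ (least-power-in P-subgroup g))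

      instance
        s≢0 : NonZero s
        s≢0 = >-nonZero s>0

      gˢ∈P : P (g ^ᴳ s) ≡ true
      gˢ∈P = proj₁ (proj₂ (proj₂ (least-power-in P-subgroup g)))

      s-least : ∀ t → 0 < t → t < s → P (g ^ᴳ t) ≢ true
      s-least = proj₂ (proj₂ (proj₂ (least-power-in P-subgroup g)))

      coset : ℕ → Fin n → Bool
      coset i x = P ((g ^ᴳ i) ⁻¹ ∙ x)

      K : Fin n → Bool
      K = unionBelow s coset

      g^qs∈P : ∀ q → P (g ^ᴳ (q * s)) ≡ true
      g^qs∈P q = subst (λ t → P t ≡ true) (sym (^ᴳ-* g s q)) (^ᴳ∈ (g ^ᴳ s) q gˢ∈P)

      coset-% : ∀ b x → coset b x ≡ true → coset (b % s) x ≡ true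
      coset-% b x e = subst (λ t → P t ≡ true) eq (∙∈ _ _ (g^qs∈P (b / s)) e)
        where
        r q : ℕ
        r = b % s
        q = b / s
        eq : g ^ᴳ (q * s) ∙ ((g ^ᴳ b) ⁻¹ ∙ x) ≡ (g ^ᴳ r) ⁻¹ ∙ x
        eq = begin
          g ^ᴳ (q * s) ∙ ((g ^ᴳ b) ⁻¹ ∙ x)
            ≡⟨ cong (λ t → g ^ᴳ (q * s) ∙ ((g ^ᴳ t) ⁻¹ ∙ x)) (m≡m%n+[m/n]*n b s) ⟩
          g ^ᴳ (q * s) ∙ ((g ^ᴳ (r + q * s)) ⁻¹ ∙ x)
            ≡⟨ cong (λ t → g ^ᴳ (q * s) ∙ (t ⁻¹ ∙ x)) (^ᴳ-+ g r (q * s)) ⟩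
          g ^ᴳ (q * s) ∙ ((g ^ᴳ r ∙ g ^ᴳ (q * s)) ⁻¹ ∙ x)
            ≡⟨ cong (λ t → g ^ᴳ (q * s) ∙ (t ∙ x)) (⁻¹-anti-homo-∙ _ _) ⟩
          g ^ᴳ (q * s) ∙ (((g ^ᴳ (q * s)) ⁻¹ ∙ (g ^ᴳ r) ⁻¹) ∙ x)
            ≡⟨ cong (g ^ᴳ (q * s) ∙_) (assoc _ _ _) ⟩
          g ^ᴳ (q * s) ∙ ((g ^ᴳ (q * s)) ⁻¹ ∙ ((g ^ᴳ r) ⁻¹ ∙ x))
            ≡⟨ \\-leftDividesˡ _ _ ⟩
          (g ^ᴳ r) ⁻¹ ∙ x ∎
          where open ≡-Reasoning

      K⁺ : ∀ b x → coset b x ≡ true → K x ≡ true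
      K⁺ b x e = unionBelow⁺ s coset x (b % s) (m%n<n b s) (coset-% b x e)

      K⁻ : ∀ x → K x ≡ true → ∃ λ b → coset b x ≡ true
      K⁻ x e with unionBelow⁻ s coset x e
      ... | i , _ , q = i , q

      coset-0 : ∀ x → coset 0 x ≡ P x
      coset-0 x = cong P (trans (cong (_∙ x) ε⁻¹≈ε) (identityˡ x))

      K-subgroup : Subgroup K
      K-subgroup = record { ε∈ = K⁺ 0 ε (trans (coset-0 ε) ε∈) ; ∙∈ = K-∙ ; ⁻¹∈ = K-⁻¹ }
        where
        K-∙ : ∀ x y → K x ≡ true → K y ≡ true → K (x ∙ y) ≡ true
        K-∙ x y x∈K y∈K with K⁻ x x∈K | K⁻ y y∈K
        ... | i , x∈gⁱP | j′ , y∈gʲP =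
          K⁺ (i + j′) (x ∙ y) (subst (λ t → P t ≡ true) eq (∙∈ _ _ (normal h c x∈gⁱP) y∈gʲP))
          where
          c h : Fin n
          c = (g ^ᴳ i) ⁻¹ ∙ x
          h = g ^ᴳ j′
          eq : (h ⁻¹ ∙ (c ∙ h)) ∙ (h ⁻¹ ∙ y) ≡ (g ^ᴳ (i + j′)) ⁻¹ ∙ (x ∙ y)
          eq = begin
            (h ⁻¹ ∙ (c ∙ h)) ∙ (h ⁻¹ ∙ y)     ≡⟨ assoc _ _ _ ⟩
            h ⁻¹ ∙ ((c ∙ h) ∙ (h ⁻¹ ∙ y))     ≡⟨ cong (h ⁻¹ ∙_) (assoc _ _ _) ⟩
            h ⁻¹ ∙ (c ∙ (h ∙ (h ⁻¹ ∙ y)))     ≡⟨ cong (λ t → h ⁻¹ ∙ (c ∙ t)) (\\-leftDividesˡ h y) ⟩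
            h ⁻¹ ∙ (c ∙ y)                    ≡⟨ cong (h ⁻¹ ∙_) (assoc _ _ _) ⟩
            h ⁻¹ ∙ ((g ^ᴳ i) ⁻¹ ∙ (x ∙ y))    ≡⟨ assoc _ _ _ ⟨
            (h ⁻¹ ∙ (g ^ᴳ i) ⁻¹) ∙ (x ∙ y)    ≡⟨ cong (_∙ (x ∙ y)) (⁻¹-anti-homo-∙ _ _) ⟨
            (g ^ᴳ i ∙ h) ⁻¹ ∙ (x ∙ y)         ≡⟨ cong (λ t → t ⁻¹ ∙ (x ∙ y)) (^ᴳ-+ g i j′) ⟨
            (g ^ᴳ (i + j′)) ⁻¹ ∙ (x ∙ y)      ∎
            where open ≡-Reasoning
        K-⁻¹ : ∀ x → K x ≡ true → K (x ⁻¹) ≡ true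
        K-⁻¹ x x∈K with K⁻ x x∈K
        ... | i , x∈gⁱP = K⁺ (i * pred (order g)) (x ⁻¹) (subst (λ t → P t ≡ true) eq (normal h (c ⁻¹) (⁻¹∈ _ x∈gⁱP)))
          where
          c h : Fin n
          c = (g ^ᴳ i) ⁻¹ ∙ x
          h = (g ^ᴳ i) ⁻¹
          g⁻ⁱ≡ : h ⁻¹ ≡ (g ^ᴳ (i * pred (order g))) ⁻¹
          g⁻ⁱ≡ = cong _⁻¹ (^ᴳ-⁻¹ g i)
          eq : h ⁻¹ ∙ (c ⁻¹ ∙ h) ≡ (g ^ᴳ (i * pred (order g))) ⁻¹ ∙ x ⁻¹
          eq = begin
            h ⁻¹ ∙ (c ⁻¹ ∙ h)            ≡⟨ cong (λ t → h ⁻¹ ∙ (t ∙ h)) (⁻¹-anti-homo-∙ _ _) ⟩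
            h ⁻¹ ∙ ((x ⁻¹ ∙ h ⁻¹) ∙ h)   ≡⟨ cong (h ⁻¹ ∙_) (//-rightDividesˡ h (x ⁻¹)) ⟩
            h ⁻¹ ∙ x ⁻¹                  ≡⟨ cong (_∙ x ⁻¹) g⁻ⁱ≡ ⟩
            (g ^ᴳ (i * pred (order g))) ⁻¹ ∙ x ⁻¹ ∎
            where open ≡-Reasoning

      cosets-disjoint : ∀ i k x → i < k → k < s → coset i x ≡ true → coset k x ≡ false
      cosets-disjoint i k x i<k k<s x∈gⁱP = Boolₚ.¬-not λ x∈gᵏP →
        s-least (k ∸ i) (m<n⇒0<n∸m i<k) (≤-<-trans (m∸n≤m k i) k<s)
                (subst (λ t → P t ≡ true) eq (∙∈ _ _ x∈gⁱP (⁻¹∈ _ x∈gᵏP)))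
        where
        eq : ((g ^ᴳ i) ⁻¹ ∙ x) ∙ ((g ^ᴳ k) ⁻¹ ∙ x) ⁻¹ ≡ g ^ᴳ (k ∸ i)
        eq = begin
          ((g ^ᴳ i) ⁻¹ ∙ x) ∙ ((g ^ᴳ k) ⁻¹ ∙ x) ⁻¹
            ≡⟨ cong (((g ^ᴳ i) ⁻¹ ∙ x) ∙_) (⁻¹-anti-homo-∙ _ _) ⟩
          ((g ^ᴳ i) ⁻¹ ∙ x) ∙ (x ⁻¹ ∙ (g ^ᴳ k) ⁻¹ ⁻¹)
            ≡⟨ cong (λ t → ((g ^ᴳ i) ⁻¹ ∙ x) ∙ (x ⁻¹ ∙ t)) (⁻¹-involutive _) ⟩
          ((g ^ᴳ i) ⁻¹ ∙ x) ∙ (x ⁻¹ ∙ g ^ᴳ k)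
            ≡⟨ assoc _ _ _ ⟩
          (g ^ᴳ i) ⁻¹ ∙ (x ∙ (x ⁻¹ ∙ g ^ᴳ k))
            ≡⟨ cong ((g ^ᴳ i) ⁻¹ ∙_) (\\-leftDividesˡ x _) ⟩
          (g ^ᴳ i) ⁻¹ ∙ g ^ᴳ k
            ≡⟨ cong (λ t → (g ^ᴳ i) ⁻¹ ∙ g ^ᴳ t) (m+[n∸m]≡n (<⇒≤ i<k)) ⟨
          (g ^ᴳ i) ⁻¹ ∙ g ^ᴳ (i + (k ∸ i))
            ≡⟨ cong ((g ^ᴳ i) ⁻¹ ∙_) (^ᴳ-+ g i _) ⟩
          (g ^ᴳ i) ⁻¹ ∙ (g ^ᴳ i ∙ g ^ᴳ (k ∸ i))
            ≡⟨ \\-leftDividesʳ _ _ ⟩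
          g ^ᴳ (k ∸ i) ∎
          where open ≡-Reasoning

      |K|≡s*p^a : count K ≡ s * p ^ a
      |K|≡s*p^a = trans (count-unionBelow s coset (count P) cosets-disjoint (λ i → count-translate P ((g ^ᴳ i) ⁻¹)))
                        (cong (s *_) |P|≡p^a)

      s∣m : s ∣ m
      s∣m = divides q (*-cancelˡ-≡ m (q * s) (p ^ a) {{m^n≢0 p a {{prime⇒nonZero p-prime}}}} (begin
        p ^ a * m            ≡⟨ n≡p^a*m ⟨
        n                    ≡⟨ count-true {n} (λ _ → true) (λ _ → refl) ⟨
        count {n} (λ _ → true) ≡⟨ _∣_.equality |K|∣|G| ⟩
        q * count K          ≡⟨ cong (q *_) |K|≡s*p^a ⟩
        q * (s * p ^ a)      ≡⟨ *-assoc q s _ ⟨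
        (q * s) * p ^ a      ≡⟨ *-comm _ (p ^ a) ⟩
        p ^ a * (q * s)      ∎))
        where
        open ≡-Reasoning
        |K|∣|G| : count K ∣ count (λ (_ : Fin n) → true)
        |K|∣|G| = lagrange K-subgroup (record { ε∈ = refl ; ∙∈ = λ _ _ _ _ → refl ; ⁻¹∈ = λ _ _ → refl }) (λ _ _ → refl)
        q : ℕ
        q = _∣_.quotient |K|∣|G|

      s∣p^j : s ∣ p ^ j
      s∣p^j = ∣-by-minimality s (p ^ j) s-least gʳ∈P
        where
        ε∈g^p^jP : coset (p ^ j) ε ≡ true
        ε∈g^p^jP = subst (λ t → P t ≡ true) (sym (trans (identityʳ _) (cong _⁻¹ g^p^j≡ε)))
                         (trans (cong P ε⁻¹≈ε) ε∈)
        gʳ∈P : P (g ^ᴳ (p ^ j % s)) ≡ true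
        gʳ∈P = subst (λ t → P t ≡ true) (⁻¹-involutive _)
                 (⁻¹∈ _ (subst (λ t → P t ≡ true) (identityʳ _) (coset-% (p ^ j) ε ε∈g^p^jP)))

    p-element⇒∈P : P g ≡ true
    p-element⇒∈P = subst (λ t → P t ≡ true) (trans (cong (g ^ᴳ_) s≡1) (^ᴳ-1 g)) gˢ∈P
      where
      s≡1 : s ≡ 1
      s≡1 = ∣p^j∧∣m⇒≡1 j p∤m s∣p^j s∣m

  module CyclicPart (u : Fin n) (k l : ℕ) (order≡p^k*l : order u ≡ p ^ k * l) (p∤l : ¬ (p ∣ l)) where

    l>0 : 0 < l
    l>0 = n≢0⇒n>0 λ l≡0 → p∤l (subst (p ∣_) (sym l≡0) (p ∣0))

    uˡ^p^k≡ε : (u ^ᴳ l) ^ᴳ (p ^ k) ≡ ε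
    uˡ^p^k≡ε = trans (sym (^ᴳ-* u l (p ^ k))) (trans (cong (u ^ᴳ_) (sym order≡p^k*l)) (^ᴳ-order u))

    uˡ∈P : P (u ^ᴳ l) ≡ true
    uˡ∈P = p-element⇒∈P (u ^ᴳ l) k uˡ^p^k≡ε

    -- uⁱ ∈ P forces l ∣ i, since uⁱ then has p-power order
    ⟨u⟩∩P≡⟨uˡ⟩ : ∀ x → (⟨ u ⟩ ∩ P) x ≡ ⟨ u ^ᴳ l ⟩ x
    ⟨u⟩∩P≡⟨uˡ⟩ x = bool-ext to from
      where
      to : (⟨ u ⟩ ∩ P) x ≡ true → ⟨ u ^ᴳ l ⟩ x ≡ true
      to e with ∈⟨⟩⇒^ᴳ u x (∧-conicalˡ _ _ e)
      ... | i , _ , refl with l∣i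
        where
        l∣i : l ∣ i
        l∣i = coprime-divisor (coprime-p^ a p∤l) (∣-trans (subst (l ∣_) (sym order≡p^k*l) (n∣m*n (p ^ k)))
                (^ᴳ≡ε⇒order∣ u (p ^ a * i) (trans (^ᴳ-* u i (p ^ a)) (∈P⇒^p^a≡ε _ (∧-conicalʳ (⟨ u ⟩ (u ^ᴳ i)) _ e)))))
      ... | divides t refl = subst (λ y → ⟨ u ^ᴳ l ⟩ y ≡ true) (sym (^ᴳ-* u l t)) (^ᴳ∈⟨⟩ (u ^ᴳ l) t)
      from : ⟨ u ^ᴳ l ⟩ x ≡ true → (⟨ u ⟩ ∩ P) x ≡ true
      from x∈ = ∧-intro (⟨⟩-trans u (u ^ᴳ l) x (^ᴳ∈⟨⟩ u l) x∈) (⟨⟩⊆ P-subgroup (u ^ᴳ l) uˡ∈P x x∈)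

    order-uˡ : order (u ^ᴳ l) ≡ p ^ k
    order-uˡ = ∣-antisym (^ᴳ≡ε⇒order∣ (u ^ᴳ l) (p ^ k) uˡ^p^k≡ε)
      (*-cancelʳ-∣ l {{>-nonZero l>0}} (subst (_∣ order (u ^ᴳ l) * l) order≡p^k*l
        (^ᴳ≡ε⇒order∣ u (order (u ^ᴳ l) * l) (trans (^ᴳ-* u l (order (u ^ᴳ l))) (^ᴳ-order (u ^ᴳ l))))))

    count-⟨u⟩∩P : count (⟨ u ⟩ ∩ P) ≡ p ^ k
    count-⟨u⟩∩P = trans (count-cong ⟨u⟩∩P≡⟨uˡ⟩) (trans (count⟨⟩≡order (u ^ᴳ l)) order-uˡ)

module Conjugation {n : ℕ} (G : FinGroup n) where

  open Counting
  open SubsetsAsPredicates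
  open GroupTheory G

  IsSubgroup⇒Subgroup : ∀ {S} → IsSubgroup G S → Subgroup (lookup S)
  IsSubgroup⇒Subgroup (ε∈ , ∙∈ , ⁻¹∈) = record
    { ε∈  = ∈⇒lookup ε∈
    ; ∙∈  = λ x y x∈ y∈ → ∈⇒lookup (∙∈ x y (lookup⇒∈ x∈) (lookup⇒∈ y∈))
    ; ⁻¹∈ = λ x x∈ → ∈⇒lookup (⁻¹∈ x (lookup⇒∈ x∈)) }

  conj : Fin n → Fin n → Fin n
  conj g y = g ∙ (y ∙ g ⁻¹)

  conj-ε : ∀ g → conj g ε ≡ ε
  conj-ε g = trans (cong (g ∙_) (identityˡ _)) (inverseʳ g)

  conj-∙ : ∀ g x y → conj g x ∙ conj g y ≡ conj g (x ∙ y)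
  conj-∙ g x y = begin
    (g ∙ (x ∙ g ⁻¹)) ∙ (g ∙ (y ∙ g ⁻¹)) ≡⟨ assoc _ _ _ ⟩
    g ∙ ((x ∙ g ⁻¹) ∙ (g ∙ (y ∙ g ⁻¹))) ≡⟨ cong (g ∙_) (assoc _ _ _) ⟩
    g ∙ (x ∙ (g ⁻¹ ∙ (g ∙ (y ∙ g ⁻¹)))) ≡⟨ cong (λ t → g ∙ (x ∙ t)) (\\-leftDividesʳ g _) ⟩
    g ∙ (x ∙ (y ∙ g ⁻¹))                ≡⟨ cong (g ∙_) (assoc _ _ _) ⟨
    g ∙ ((x ∙ y) ∙ g ⁻¹)                ∎
    where open ≡-Reasoning

  conj-⁻¹ : ∀ g x → (conj g x) ⁻¹ ≡ conj g (x ⁻¹)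
  conj-⁻¹ g x = begin
    (g ∙ (x ∙ g ⁻¹)) ⁻¹       ≡⟨ ⁻¹-anti-homo-∙ _ _ ⟩
    (x ∙ g ⁻¹) ⁻¹ ∙ g ⁻¹      ≡⟨ cong (_∙ g ⁻¹) (⁻¹-anti-homo-∙ _ _) ⟩
    (g ⁻¹ ⁻¹ ∙ x ⁻¹) ∙ g ⁻¹   ≡⟨ cong (λ t → (t ∙ x ⁻¹) ∙ g ⁻¹) (⁻¹-involutive g) ⟩
    (g ∙ x ⁻¹) ∙ g ⁻¹         ≡⟨ assoc _ _ _ ⟩
    g ∙ (x ⁻¹ ∙ g ⁻¹)         ∎
    where open ≡-Reasoning

  conj-conj⁻¹ : ∀ g y → conj g (g ⁻¹ ∙ (y ∙ g)) ≡ y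
  conj-conj⁻¹ g y = trans (cong (g ∙_) (trans (assoc _ _ _) (cong (g ⁻¹ ∙_) (//-rightDividesʳ g y))))
                          (\\-leftDividesˡ g y)

  conj⁻¹-conj : ∀ g y → g ⁻¹ ∙ (conj g y ∙ g) ≡ y
  conj⁻¹-conj g y = trans (cong (g ⁻¹ ∙_) (trans (assoc _ _ _) (cong (g ∙_) (//-rightDividesˡ g y))))
                          (\\-leftDividesʳ g y)

  conjugate : Fin n → Subset n → Subset n
  conjugate g S = tabulate (lookup S ∘ conj g)

  conjugate-Sylow : ∀ {p S} g → IsSylow G p S → IsSylow G p (conjugate g S)
  conjugate-Sylow {S = S} g ((ε∈ , ∙∈ , ⁻¹∈) , k , |S|≡p^k , rest) =
    (ε∈′ , ∙∈′ , ⁻¹∈′) , k , trans (∣∣≡count (conjugate g S)) (trans |S^g|≡|S| (trans (sym (∣∣≡count S)) |S|≡p^k)) , rest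
    where
    ∈conjugate⁺ : ∀ {y} → conj g y ∈ S → y ∈ conjugate g S
    ∈conjugate⁺ = ∈-tabulate⁺ ∘ ∈⇒lookup
    ∈conjugate⁻ : ∀ {y} → y ∈ conjugate g S → conj g y ∈ S
    ∈conjugate⁻ = lookup⇒∈ ∘ ∈-tabulate⁻
    ε∈′ : ε ∈ conjugate g S
    ε∈′ = ∈conjugate⁺ (subst (_∈ S) (sym (conj-ε g)) ε∈)
    ∙∈′ : ∀ x y → x ∈ conjugate g S → y ∈ conjugate g S → (x ∙ y) ∈ conjugate g S
    ∙∈′ x y x∈ y∈ = ∈conjugate⁺ (subst (_∈ S) (conj-∙ g x y) (∙∈ _ _ (∈conjugate⁻ x∈) (∈conjugate⁻ y∈)))
    ⁻¹∈′ : ∀ x → x ∈ conjugate g S → (x ⁻¹) ∈ conjugate g S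
    ⁻¹∈′ x x∈ = ∈conjugate⁺ (subst (_∈ S) (conj-⁻¹ g x) (⁻¹∈ _ (∈conjugate⁻ x∈)))
    |S^g|≡|S| : count (lookup (conjugate g S)) ≡ count (lookup S)
    |S^g|≡|S| = trans (count-cong (lookup∘tabulate (lookup S ∘ conj g)))
                      (count-permute (lookup S) (conj g) (λ y → g ⁻¹ ∙ (y ∙ g)) (conj-conj⁻¹ g) (conj⁻¹-conj g))

  unique-Sylow⇒normal : ∀ {p S} → IsSylow G p S → (∀ T → IsSylow G p T → T ≡ S) →
    ∀ g x → lookup S x ≡ true → lookup S (g ⁻¹ ∙ (x ∙ g)) ≡ true
  unique-Sylow⇒normal {S = S} sylow unique g x x∈S = begin
    lookup S (g ⁻¹ ∙ (x ∙ g))                   ≡⟨ cong (λ T → lookup T (g ⁻¹ ∙ (x ∙ g))) (unique _ (conjugate-Sylow g sylow)) ⟨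
    lookup (conjugate g S) (g ⁻¹ ∙ (x ∙ g))     ≡⟨ lookup∘tabulate (lookup S ∘ conj g) _ ⟩
    lookup S (conj g (g ⁻¹ ∙ (x ∙ g)))          ≡⟨ cong (lookup S) (conj-conj⁻¹ g x) ⟩
    lookup S x                                  ≡⟨ x∈S ⟩
    true                                        ∎
    where open ≡-Reasoning

module PComponent {n : ℕ} (G : FinGroup n) {p : ℕ} (p-prime : Prime p)
  {Gp : Subset n} (Gp-subgroup : GroupTheory.Subgroup G (lookup Gp)) {a m : ℕ}
  (|Gp|≡p^a : Counting.count (lookup Gp) ≡ p ^ a) (n≡p^a*m : n ≡ p ^ a * m) (p∤m : ¬ (p ∣ m))
  (normal : ∀ g x → lookup Gp x ≡ true →
            lookup Gp (GroupTheory._∙_ G (GroupTheory._⁻¹ G g) (GroupTheory._∙_ G x g)) ≡ true)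
  (V : Subset n) (component : IsPComponent (EPGAdj G) p V)
  where

  open Counting
  open SubsetsAsPredicates
  open GroupTheory G
  open MaximalCyclic G
  open NormalSylow G p-prime Gp-subgroup {a} {m} |Gp|≡p^a n≡p^a*m p∤m normal
  open PrimePowers p-prime using (p-part)

  P : Fin n → Bool
  P = lookup Gp

  inClosure : Fin n → Fin n → Bool
  inClosure w = lookup (closure w)

  V∩closure≡P∩closure : ∀ w → count (lookup V ∩ inClosure w) ≡ count (P ∩ inClosure w)
  V∩closure≡P∩closure w with closure-cyclic w
  ... | u , closure≡⟨u⟩ with p-part (order u) (>-nonZero⁻¹ (order u))
  ...   | k , l , order≡p^k*l , p∤l = begin
    count (lookup V ∩ inClosure w) ≡⟨ count-cong (λ x → Boolₚ.∧-comm (lookup V x) _) ⟩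
    count (inClosure w ∩ lookup V) ≡⟨ ∣∩∣≡count (closure w) V ⟨
    ∣ closure w Sub.∩ V ∣          ≡⟨ component (closure w) (closure∈𝓑 w) k l |closure|≡p^k*l p∤l ⟩
    p ^ k                          ≡⟨ CyclicPart.count-⟨u⟩∩P u k l order≡p^k*l p∤l ⟨
    count (⟨ u ⟩ ∩ P)              ≡⟨ count-cong (λ x → trans (Boolₚ.∧-comm (P x) _) (cong (_∧ P x) (closure≡⟨u⟩ x))) ⟨
    count (P ∩ inClosure w)        ∎
    where
    open ≡-Reasoning
    |closure|≡p^k*l : ∣ closure w ∣ ≡ p ^ k * l
    |closure|≡p^k*l = trans (∣∣≡count (closure w)) (trans (count-cong closure≡⟨u⟩) (trans (count⟨⟩≡order u) order≡p^k*l))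

  open Classifier (≡-dec Boolₚ._≟_) closure

  inClosure-saturated : ∀ w → Saturated (inClosure w)
  inClosure-saturated w x y x∈ x~y =
    ∈⇒lookup (closure-mono (lookup⇒∈ x∈) (subst (y ∈_) (sym (sameClass⁻ x~y)) (closure-self y)))

  closure-shrinks : ∀ {w y} → y ∈ closure w → closure w ≢ closure y → count (inClosure y) < count (inClosure w)
  closure-shrinks {w} {y} y∈ w≢y = ≰⇒> λ w≤y → w≢y (⊆-antisym
    (λ {x} x∈ → lookup⇒∈ (⊆∧count≤⇒⊇ (inClosure y) (inClosure w) y⊆w w≤y x (∈⇒lookup x∈)))
    (λ x∈ → closure-mono y∈ x∈))
    where
    y⊆w : ∀ x → inClosure y x ≡ true → inClosure w x ≡ true
    y⊆w x x∈ = ∈⇒lookup (closure-mono y∈ (lookup⇒∈ x∈))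

  -- Induction on |closure w|: closure w is the class of w together with classes of strictly
  -- smaller closures, and on closure w itself the counts agree by the p-component property.
  classCountsAgree : ClassCountsAgree (lookup V) P
  classCountsAgree w = go (suc n) w (s≤s (count≤n (inClosure w)))
    where
    go : ∀ k w → count (inClosure w) < k → count (lookup V ∩ sameClass w) ≡ count (P ∩ sameClass w)
    go (suc k) w bound = +-cancelʳ-≡ _ _ _ (begin
      count (lookup V ∩ sameClass w) + count (lookup V ∩ D) ≡⟨ count-removeClass (lookup V) (inClosure w) w sat self ⟨
      count (lookup V ∩ inClosure w)                        ≡⟨ V∩closure≡P∩closure w ⟩
      count (P ∩ inClosure w)                               ≡⟨ count-removeClass P (inClosure w) w sat self ⟩
      count (P ∩ sameClass w) + count (P ∩ D)               ≡⟨ cong (count (P ∩ sameClass w) +_) V∩D≡P∩D ⟨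
      count (P ∩ sameClass w) + count (lookup V ∩ D)        ∎)
      where
      open ≡-Reasoning
      D : Fin n → Bool
      D = removeClass w (inClosure w)
      sat : Saturated (inClosure w)
      sat = inClosure-saturated w
      self : inClosure w w ≡ true
      self = ∈⇒lookup (closure-self w)
      smaller : ∀ y → D y ≡ true → count (lookup V ∩ sameClass y) ≡ count (P ∩ sameClass y)
      smaller y y∈D = go k y (≤-trans (closure-shrinks (lookup⇒∈ (∧-conicalˡ _ _ y∈D)) w≢y) (≤-pred bound))
        where
        w≢y : closure w ≢ closure y
        w≢y eq = true≢false (sameClass⁺ eq) (not-true (∧-conicalʳ (inClosure w y) _ y∈D))
      V∩D≡P∩D : count (lookup V ∩ D) ≡ count (P ∩ D)
      V∩D≡P∩D = count-saturated (lookup V) P D (removeClass-saturated w (inClosure w) sat) smaller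

  module B = ClassBijection (classBijection (lookup V) P classCountsAgree)

  Σ-≡ : ∀ {S : Subset n} {a b : Σ (Fin n) (_∈ S)} → proj₁ a ≡ proj₁ b → a ≡ b
  Σ-≡ {a = x , x∈} {.x , x∈′} refl = cong (x ,_) ([]=-irrelevant x∈ x∈′)

  to : Σ (Fin n) (_∈ V) → Σ (Fin n) (_∈ Gp)
  to (x , x∈V) = proj₁ (B.to (x , ∈⇒lookup x∈V)) , lookup⇒∈ (proj₂ (B.to (x , ∈⇒lookup x∈V)))

  to-injective : ∀ {a b} → to a ≡ to b → a ≡ b
  to-injective e = Σ-≡ (B.injective _ _ (cong proj₁ e))

  to-surjective : ∀ y → ∃ λ a → ∀ {b} → b ≡ a → to b ≡ y
  to-surjective (y , y∈Gp) = (x , lookup⇒∈ x∈V) , λ { refl → Σ-≡ to-x≡y }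
    where
    x : Fin n
    x = proj₁ (proj₁ (B.surjective y (∈⇒lookup y∈Gp)))
    x∈V : lookup V x ≡ true
    x∈V = proj₂ (proj₁ (B.surjective y (∈⇒lookup y∈Gp)))
    to-x≡y : proj₁ (to (x , lookup⇒∈ x∈V)) ≡ y
    to-x≡y = trans (cong (λ pf → proj₁ (B.to (x , pf))) (bool-irrelevant _ x∈V)) (proj₂ (B.surjective y (∈⇒lookup y∈Gp)))

  closure-to : ∀ a → closure (proj₁ (to a)) ≡ closure (proj₁ a)
  closure-to (x , x∈V) = B.class-preserving (x , ∈⇒lookup x∈V)

  -- to c has the same closure as c, hence lies in the same maximal cyclic subgroups.
  image∈p-part : ∀ z → Maximal z → ∀ k l (order≡p^k*l : order z ≡ p ^ k * l) (p∤l : ¬ (p ∣ l)) →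
    ∀ c → ⟨ z ⟩ (proj₁ c) ≡ true → ⟨ z ^ᴳ l ⟩ (proj₁ (to c)) ≡ true
  image∈p-part z maximal k l order≡p^k*l p∤l c c∈⟨z⟩ = trans (sym (Z.⟨u⟩∩P≡⟨uˡ⟩ (proj₁ (to c))))
    (∧-intro (closure≡⇒maximal-through (sym (closure-to c)) z maximal c∈⟨z⟩) (∈⇒lookup (proj₂ (to c))))
    where
    module Z = CyclicPart z k l order≡p^k*l p∤l

  to-preserves-Adj : ∀ a b → EPGAdj G (proj₁ a) (proj₁ b) → Adj (EnhancedPowerGraphSub G Gp) (to a) (to b)
  to-preserves-Adj a b a~b =
    (λ e → proj₁ a~b (cong proj₁ (to-injective {a} {b} (Σ-≡ {S = Gp} {to a} {to b} e)))) ,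
    z ^ᴳ l , lookup⇒∈ (CyclicPart.uˡ∈P z k l order≡p^k*l p∤l) ,
    ∈⟨⟩⇒InCyclic _ _ (image∈p-part z maximal k l order≡p^k*l p∤l a a∈⟨z⟩) ,
    ∈⟨⟩⇒InCyclic _ _ (image∈p-part z maximal k l order≡p^k*l p∤l b b∈⟨z⟩)
    where
    z : Fin n
    z = proj₁ (Adj⁻ a~b)
    maximal : Maximal z
    maximal = proj₁ (proj₂ (Adj⁻ a~b))
    a∈⟨z⟩ : ⟨ z ⟩ (proj₁ a) ≡ true
    a∈⟨z⟩ = proj₁ (proj₂ (proj₂ (Adj⁻ a~b)))
    b∈⟨z⟩ : ⟨ z ⟩ (proj₁ b) ≡ true
    b∈⟨z⟩ = proj₂ (proj₂ (proj₂ (Adj⁻ a~b)))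
    k l : ℕ
    k = proj₁ (p-part (order z) (>-nonZero⁻¹ (order z)))
    l = proj₁ (proj₂ (p-part (order z) (>-nonZero⁻¹ (order z))))
    order≡p^k*l : order z ≡ p ^ k * l
    order≡p^k*l = proj₁ (proj₂ (proj₂ (p-part (order z) (>-nonZero⁻¹ (order z)))))
    p∤l : ¬ (p ∣ l)
    p∤l = proj₂ (proj₂ (proj₂ (p-part (order z) (>-nonZero⁻¹ (order z)))))

  to-reflects-Adj : ∀ a b → Adj (EnhancedPowerGraphSub G Gp) (to a) (to b) → EPGAdj G (proj₁ a) (proj₁ b)
  to-reflects-Adj a b (to-a≢to-b , z , _ , a′∈⟨z⟩ , b′∈⟨z⟩) =
    Adj⁺ z′ (λ e → to-a≢to-b (cong proj₁ (cong to (Σ-≡ {S = V} {a} {b} e)))) (preimage∈ a a′∈⟨z⟩) (preimage∈ b b′∈⟨z⟩)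
    where
    z′ : Fin n
    z′ = proj₁ (maximal-above z)
    preimage∈ : ∀ c → InCyclic G (proj₁ (to c)) z → ⟨ z′ ⟩ (proj₁ c) ≡ true
    preimage∈ c c′∈⟨z⟩ = closure≡⇒maximal-through (closure-to c) z′ (proj₁ (proj₂ (maximal-above z)))
      (⟨⟩-trans z′ z (proj₁ (to c)) (proj₂ (proj₂ (maximal-above z))) (InCyclic⇒∈⟨⟩ (proj₁ (to c)) z c′∈⟨z⟩))

  iso : Iso (Induced (EPGAdj G) V) (EnhancedPowerGraphSub G Gp)
  iso = mk⤖ {to = to} (to-injective , to-surjective) , λ a b → to-preserves-Adj a b , to-reflects-Adj a b

mainTheorem18 : ∀ {n : ℕ} (G : FinGroup n) (p : ℕ) → Prime p →
    (Gp : Subset n) → IsSylow G p Gp → (∀ T → IsSylow G p T → T ≡ Gp) →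
    ∀ (V : Subset n) → IsPComponent (EPGAdj G) p V →
    Iso (Induced (EPGAdj G) V) (EnhancedPowerGraphSub G Gp)
mainTheorem18 G p p-prime Gp sylow@(Gp-subgroup , a , |Gp|≡p^a , m , n≡p^a*m , p∤m) unique V component =
  PComponent.iso G p-prime (IsSubgroup⇒Subgroup Gp-subgroup) {a} {m} (trans (sym (∣∣≡count Gp)) |Gp|≡p^a)
    n≡p^a*m p∤m (unique-Sylow⇒normal sylow unique) V component
  where
  open Conjugation G
  open Counting using (∣∣≡count)
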